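{- There is a constant $c>0$ such that every two-dimensional torus graph $G$ with $n$ vertices satisfies $\widetilde{\mathsf{VC}}(G)\ge c\,n^{3/2}$.
   Context: The two-dimensional torus with $n$ vertices is the $\sqrt n\times\sqrt n$ grid with wrap-around edges (Cartesian product of two cycles of length $\sqrt n$). Unweighted deterministic walk: each vertex $u$ has a rotor sequence of length $\tilde d(u)$ of neighbours of $u$, each occurring exactly $\tilde d(u)/\deg(u)$ times, and an initial rotor position; the walk moves from the current vertex to the vertex its rotor points at and then advances that rotor cyclically. $\widetilde{\mathsf{VC}}(G)$ is the maximum over start vertices and all rotor sequences/initial positions (lengths fixed) of the least $t$ by which all vertices have been visited. -}

module Defs where

open import Data.Nat using (ℕ; zero; suc; _+_; _*_; _%_; _≤_; _<_; NonZero)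
open import Data.Nat.DivMod using (m%n<n)
open import Data.Fin using (Fin; toℕ; fromℕ<) renaming (_≟_ to _≟F_)
open import Data.Fin.Properties using ()
open import Data.Product using (Σ; ∃; _×_; _,_; proj₁; proj₂)
open import Data.Product.Properties using (≡-dec)
open import Data.Sum using (_⊎_)
open import Data.List using (List; length; filter; allFin)
open import Data.Bool using (if_then_else_)
open import Relation.Nullary using (does)
open import Relation.Binary.PropositionalEquality using (_≡_)
open import Relation.Binary.Definitions using (DecidableEquality)

-- Vertices of the two-dimensional torus C_k □ C_k (n = k * k vertices).
V : ℕ → Set
V k = Fin k × Fin k

_≟V_ : ∀ {k} → DecidableEquality (V k)
_≟V_ = ≡-dec _≟F_ _≟F_

-- adjacency in the cycle C_k on {0,…,k-1}: i and j differ by one modulo k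
CycAdj : ∀ {k} → Fin k → Fin k → Set
CycAdj {k} i j =
  (suc (toℕ i) ≡ toℕ j) ⊎ (suc (toℕ j) ≡ toℕ i) ⊎
  ((toℕ i ≡ 0) × (suc (toℕ j) ≡ k)) ⊎ ((toℕ j ≡ 0) × (suc (toℕ i) ≡ k))

Adj : ∀ {k} → V k → V k → Set
Adj (a , b) (c , d) = ((a ≡ c) × CycAdj b d) ⊎ ((b ≡ d) × CycAdj a c)

-- degree of every vertex of the torus (k ≥ 3)
deg : ℕ
deg = 4

-- rotor sequence length at u: d̃(u) = deg * (multiplicity), multiplicity = suc (m u) ≥ 1
Len : ∀ {k} → (V k → ℕ) → V k → ℕ
Len m u = deg * suc (m u)

count : ∀ {k n} → (Fin n → V k) → V k → ℕ
count {n = n} f w = length (filter (λ i → f i ≟V w) (allFin n))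

-- A rotor system with lengths Len m: rotor sequences in which every entry is a
-- neighbour and each neighbour occurs exactly d̃(u)/deg(u) = suc (m u) times,
-- together with initial rotor positions.
record RotorSystem (k : ℕ) (m : V k → ℕ) : Set where
  field
    seq     : (u : V k) → Fin (Len m u) → V k
    seq-adj : ∀ u i → Adj u (seq u i)
    seq-cnt : ∀ u w → Adj u w → count (seq u) w ≡ suc (m u)
    init    : (u : V k) → Fin (Len m u)

open RotorSystem public

-- State of the walk: current vertex and, for each vertex v, a counter c v;
-- the rotor of v currently points at position (c v mod d̃(v)), so incrementing
-- the counter advances the rotor cyclically.
State : ℕ → Set
State k = V k × (V k → ℕ)

rotorIndex : ∀ {k} (m : V k → ℕ) (v : V k) → ℕ → Fin (Len m v)
rotorIndex m v c = fromℕ< (m%n<n c (Len m v))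

step : ∀ {k} {m : V k → ℕ} → RotorSystem k m → State k → State k
step {m = m} R (x , c) =
  ( seq R x (rotorIndex m x (c x))
  , λ v → if does (v ≟V x) then suc (c v) else c v )

walkState : ∀ {k} {m : V k → ℕ} → RotorSystem k m → V k → ℕ → State k
walkState {m = m} R s zero = s , λ v → toℕ (init R v)
walkState R s (suc t) = step R (walkState R s t)

walk : ∀ {k} {m : V k → ℕ} → RotorSystem k m → V k → ℕ → V k
walk R s t = proj₁ (walkState R s t)

CoveredBy : ∀ {k} {m : V k → ℕ} → RotorSystem k m → V k → ℕ → Set
CoveredBy {k} R s t = ∀ (v : V k) → ∃ λ i → i ≤ t × walk R s i ≡ v

module Submission where

-- Every rotor sequence repeats the directions of a period-4 pattern
-- read through a table that depends on the column only (column 0, columns 1..R,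
-- the others), so the walk depends on each counter modulo 4 only.  All side rotors
-- first point back towards column 0.  The walk then runs in phases: phase r starts
-- at the origin with the columns at distance ≤ r from column 0 explored, tours each
-- of these 2r side columns (two laps of k steps each), sweeps every row, and returns
-- to the origin with the columns at distance r + 1 explored.  Phase r thus lasts at
-- least k(2r + 1) steps, and during the first R ≈ k/2 phases (≥ k R² steps) the
-- vertex (R + 1, 0) is never visited.

open import Data.Bool using (Bool; true; false; if_then_else_; _∧_; _∨_; not)
open import Data.Bool.Properties using (∧-comm; ∧-identityʳ; ∧-zeroʳ)
open import Data.Empty using (⊥-elim)
open import Data.Fin using (Fin; toℕ; fromℕ<) renaming (zero to fz; suc to fs)
open import Data.Fin.Properties using (toℕ<n; toℕ-fromℕ<; toℕ-injective)
open import Data.List using (length; filter; tabulate)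
open import Data.Nat
open import Data.Nat.DivMod using (m≡m%n+[m/n]*n; m%n<n; _%_; _/_)
open import Data.Nat.Properties
open import Data.Nat.Solver using (module +-*-Solver)
open import Data.Product using (Σ; ∃; _×_; _,_; proj₁; proj₂)
open import Data.Sum using (_⊎_; inj₁; inj₂)
open import Function using (id; _∘_; _$_; _⟨_⟩_)
open import Level using (0ℓ)
open import Relation.Binary.Definitions using (DecidableEquality; tri<; tri≈; tri>)
open import Relation.Binary.PropositionalEquality
open import Relation.Nullary using (does; proof; yes; no)
open import Relation.Nullary.Reflects using (Reflects; ofʸ; ofⁿ; det; fromEquivalence; _×-reflects_)
open import Relation.Unary using (Pred; Decidable)
open +-*-Solver using (solve; _:=_; _:+_; _:*_; con)

open import Defs

≡ᵇ-reflects-≡ : ∀ m n → Reflects (m ≡ n) (m ≡ᵇ n)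
≡ᵇ-reflects-≡ m n = fromEquivalence (≡ᵇ⇒≡ m n) (≡⇒≡ᵇ m n)

≡ᵇ-true : ∀ {m n} → m ≡ n → (m ≡ᵇ n) ≡ true
≡ᵇ-true {m} {n} e = det (≡ᵇ-reflects-≡ m n) (ofʸ e)

≡ᵇ-false : ∀ {m n} → m ≢ n → (m ≡ᵇ n) ≡ false
≡ᵇ-false {m} {n} ne = det (≡ᵇ-reflects-≡ m n) (ofⁿ ne)

<ᵇ-true : ∀ {m n} → m < n → (m <ᵇ n) ≡ true
<ᵇ-true {m} {n} lt = det (<ᵇ-reflects-< m n) (ofʸ lt)

<ᵇ-false : ∀ {m n} → n ≤ m → (m <ᵇ n) ≡ false
<ᵇ-false {m} {n} ge = det (<ᵇ-reflects-< m n) (ofⁿ (≤⇒≯ ge))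

reflects-⇔ : ∀ {P Q : Set} {b} → (P → Q) → (Q → P) → Reflects P b → Reflects Q b
reflects-⇔ f _ (ofʸ p) = ofʸ (f p)
reflects-⇔ _ g (ofⁿ ¬p) = ofⁿ (¬p ∘ g)

-- `inRange lo n a` tests a ∈ [lo, lo + n).  It is kept opaque so that proofs only
-- use it through the reflection lemma below.
opaque
  inRange : ℕ → ℕ → ℕ → Bool
  inRange lo n a = (lo ≤ᵇ a) ∧ (a <ᵇ lo + n)

  inRange-reflects : ∀ lo n a → Reflects (lo ≤ a × a < lo + n) (inRange lo n a)
  inRange-reflects lo n a = ≤ᵇ-reflects-≤ lo a ×-reflects <ᵇ-reflects-< a (lo + n)

inRange-true : ∀ {lo n a} → lo ≤ a → a < lo + n → inRange lo n a ≡ true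
inRange-true {lo} {n} {a} p q = det (inRange-reflects lo n a) (ofʸ (p , q))

inRange-below : ∀ {lo n a} → a < lo → inRange lo n a ≡ false
inRange-below {lo} {n} {a} a<lo = det (inRange-reflects lo n a) (ofⁿ (λ (p , _) → <⇒≱ a<lo p))

inRange-above : ∀ {lo n a} → lo + n ≤ a → inRange lo n a ≡ false
inRange-above {lo} {n} {a} ge = det (inRange-reflects lo n a) (ofⁿ (λ (_ , q) → <⇒≱ q ge))

inRange-empty : ∀ lo a → inRange lo 0 a ≡ false
inRange-empty lo a = det (inRange-reflects lo 0 a)
  (ofⁿ (λ (p , q) → <⇒≱ q (subst (_≤ a) (sym (+-identityʳ lo)) p)))

inRange-suc : ∀ {lo n a} → a ≢ lo + n → inRange lo (suc n) a ≡ inRange lo n a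
inRange-suc {lo} {n} {a} ne = det (inRange-reflects lo (suc n) a) (extend (inRange-reflects lo n a))
  where
  extend : ∀ {b} → Reflects (lo ≤ a × a < lo + n) b → Reflects (lo ≤ a × a < lo + suc n) b
  extend (ofʸ (p , q)) = ofʸ (p , subst (a <_) (sym (+-suc lo n)) (m<n⇒m<1+n q))
  extend (ofⁿ outside) = ofⁿ λ (p , q) → outside (p , ≤∧≢⇒< (≤-pred (subst (a <_) (+-suc lo n) q)) ne)

-- The rotor of a vertex with counter c is in state
-- q(c mod 4); `fresh` is q0 for a vertex that has never been left (counter 0), the
-- information that certifies that a vertex has not been visited.
data Rotor : Set where
  fresh q0 q1 q2 q3 : Rotor

advance : Rotor → Rotor
advance fresh = q1
advance q0 = q1
advance q1 = q2
advance q2 = q3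
advance q3 = q0

advanceIf : Bool → Rotor → Rotor
advanceIf true x = advance x
advanceIf false x = x

advanceIf-comm : ∀ p q x → advanceIf p (advanceIf q x) ≡ advanceIf q (advanceIf p x)
advanceIf-comm true true x = refl
advanceIf-comm true false x = refl
advanceIf-comm false true x = refl
advanceIf-comm false false x = refl

data Dir : Set where
  dE dW dN dS : Dir

_≟D_ : DecidableEquality Dir
dE ≟D dE = yes refl
dE ≟D dW = no λ ()
dE ≟D dN = no λ ()
dE ≟D dS = no λ ()
dW ≟D dE = no λ ()
dW ≟D dW = yes refl
dW ≟D dN = no λ ()
dW ≟D dS = no λ ()
dN ≟D dE = no λ ()
dN ≟D dW = no λ ()
dN ≟D dN = yes refl
dN ≟D dS = no λ ()
dS ≟D dE = no λ ()
dS ≟D dW = no λ ()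
dS ≟D dN = no λ ()
dS ≟D dS = yes refl

-- In the side tables q1
-- points north, q2 south, and q0 (in particular a fresh rotor) back towards
-- column 0, so that a newly reached column sends the walk straight back.
centreDir rightDir leftDir : Rotor → Dir
centreDir fresh = dN
centreDir q0 = dN
centreDir q1 = dS
centreDir q2 = dE
centreDir q3 = dW
rightDir fresh = dW
rightDir q0 = dW
rightDir q1 = dN
rightDir q2 = dS
rightDir q3 = dE
leftDir fresh = dE
leftDir q0 = dE
leftDir q1 = dN
leftDir q2 = dS
leftDir q3 = dW

-- A table of rotor states of all positions (only positions in the k × k square matter),
-- and a configuration of the model walk: current position and table.
Table : Set
Table = ℕ → ℕ → Rotor

Config : Set
Config = (ℕ × ℕ) × Table

module Torus (k : ℕ) where

  wrap : ℕ → ℕ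
  wrap x = if x ≡ᵇ k then 0 else x

  east : ℕ → ℕ
  east a = wrap (suc a)

  west : ℕ → ℕ
  west zero = pred k
  west (suc a) = a

  move : Dir → ℕ × ℕ → ℕ × ℕ
  move dE (a , b) = east a , b
  move dW (a , b) = west a , b
  move dN (a , b) = a , east b
  move dS (a , b) = a , west b

  InSquare : ℕ × ℕ → Set
  InSquare (a , b) = a < k × b < k

  wrap-lt : ∀ {x} → x < k → wrap x ≡ x
  wrap-lt {x} x<k rewrite ≡ᵇ-false {x} {k} (λ e → <-irrefl e x<k) = refl

  wrap-k : wrap k ≡ 0
  wrap-k rewrite ≡ᵇ-true {k} refl = refl

  east-lt : ∀ {a} → a < k → east a < k
  east-lt {a} a<k with suc a ≡ᵇ k | ≡ᵇ-reflects-≡ (suc a) k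
  ... | true | ofʸ _ = ≤-trans (s≤s z≤n) a<k
  ... | false | ofⁿ ne = ≤∧≢⇒< a<k ne

  west-lt : ∀ {a} → a < k → west a < k
  west-lt {zero} (s≤s z≤n) = ≤-refl
  west-lt {suc a} a<k = <-trans (n<1+n a) a<k

  move-in : ∀ d p → InSquare p → InSquare (move d p)
  move-in dE (a , b) (x , y) = east-lt x , y
  move-in dW (a , b) (x , y) = west-lt x , y
  move-in dN (a , b) (x , y) = x , east-lt y
  move-in dS (a , b) (x , y) = x , west-lt y

module Walk (k R : ℕ) where

  open Torus k public

  dir : ℕ → Rotor → Dir
  dir zero = centreDir
  dir (suc a) = if a <ᵇ R then rightDir else leftDir

  bump : Table → ℕ × ℕ → Table
  bump f (a , b) x y = advanceIf ((x ≡ᵇ a) ∧ (y ≡ᵇ b)) (f x y)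

  mstep : Config → Config
  mstep ((a , b) , f) = move (dir a (f a b)) (a , b) , bump f (a , b)

  run : Config → ℕ → Config
  run s zero = s
  run s (suc n) = mstep (run s n)

  -- All lemmas about runs are stated up to `≈`, which
  -- lets tables be described by convenient formulas.
  record _≈_ (s t : Config) : Set where
    constructor mk≈
    field
      same-pos   : proj₁ s ≡ proj₁ t
      in-square  : InSquare (proj₁ t)
      same-table : ∀ a b → a < k → b < k → proj₂ s a b ≡ proj₂ t a b
  open _≈_ public

  ≈-refl : ∀ {p f} → InSquare p → (p , f) ≈ (p , f)
  ≈-refl i = mk≈ refl i (λ _ _ _ _ → refl)

  ≈-trans : ∀ {s t u} → s ≈ t → t ≈ u → s ≈ u
  ≈-trans (mk≈ p₁ _ w₁) (mk≈ p₂ i₂ w₂) =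
    mk≈ (trans p₁ p₂) i₂ (λ a b ak bk → trans (w₁ a b ak bk) (w₂ a b ak bk))

  ≈-table : ∀ {s p f g} → s ≈ (p , f) → (∀ a b → a < k → b < k → f a b ≡ g a b) → s ≈ (p , g)
  ≈-table (mk≈ p₁ i₁ w₁) e = mk≈ p₁ i₁ (λ a b ak bk → trans (w₁ a b ak bk) (e a b ak bk))

  ≈-pos : ∀ {s p q f} → s ≈ (p , f) → p ≡ q → s ≈ (q , f)
  ≈-pos e refl = e

  mstep-cong : ∀ {s t} → s ≈ t → mstep s ≈ mstep t
  mstep-cong {(a , b) , f} {.(a , b) , g} (mk≈ refl (ak , bk) w) =
    mk≈ (cong (λ z → move (dir a z) (a , b)) (w a b ak bk))
        (move-in (dir a (g a b)) (a , b) (ak , bk))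
        (λ x y xk yk → cong (advanceIf ((x ≡ᵇ a) ∧ (y ≡ᵇ b))) (w x y xk yk))

  run-cong : ∀ {s t} n → s ≈ t → run s n ≈ run t n
  run-cong zero e = e
  run-cong (suc n) e = mstep-cong (run-cong n e)

  run-+ : ∀ s m n → run s (m + n) ≡ run (run s m) n
  run-+ s m zero rewrite +-identityʳ m = refl
  run-+ s m (suc n) rewrite +-suc m n = cong mstep (run-+ s m n)

  run-suc : ∀ s n → run s (suc n) ≡ run (mstep s) n
  run-suc s n = run-+ s 1 n

  then : ∀ {s} m n {u t} → run s m ≈ u → run u n ≈ t → run s (m + n) ≈ t
  then {s} m n e₁ e₂ rewrite run-+ s m n = ≈-trans (run-cong n e₁) e₂

  mstep≈ : ∀ {s a b f d} → s ≈ ((a , b) , f) → dir a (f a b) ≡ d → mstep s ≈ (move d (a , b) , bump f (a , b))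
  mstep≈ {s} {a} {b} {f} e refl with mstep-cong {s} {(a , b) , f} e
  ... | mk≈ p₁ _ w₁ = mk≈ p₁ (move-in (dir a (f a b)) (a , b) (in-square e)) w₁

  chain : ∀ {s t u} m n → run s m ≈ t → (∀ {s′} → s′ ≈ t → run s′ n ≈ u) → run s (m + n) ≈ u
  chain m n e f = then m n e (f (≈-refl (in-square e)))

  advance-extend : ∀ lo n a c x →
    advanceIf (c ∧ (a ≡ᵇ lo + n)) (advanceIf (c ∧ inRange lo n a) x) ≡ advanceIf (c ∧ inRange lo (suc n) a) x
  advance-extend lo n a false x = refl
  advance-extend lo n a true x with a ≡ᵇ lo + n | ≡ᵇ-reflects-≡ a (lo + n)
  ... | true | ofʸ refl
    rewrite inRange-above {lo} {n} {lo + n} ≤-refl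
          | inRange-true {lo} {suc n} {lo + n} (m≤m+n lo n) (+-monoʳ-< lo (n<1+n n)) = refl
  ... | false | ofⁿ ne rewrite inRange-suc {lo} {n} {a} ne = refl

  advanceRow : ℕ → ℕ → ℕ → Table → Table
  advanceRow y lo n f a b = advanceIf ((b ≡ᵇ y) ∧ inRange lo n a) (f a b)

  advanceCol : ℕ → ℕ → ℕ → Table → Table
  advanceCol x lo n f a b = advanceIf ((a ≡ᵇ x) ∧ inRange lo n b) (f a b)

  advanceColumn : ℕ → Table → Table
  advanceColumn x f a b = advanceIf (a ≡ᵇ x) (f a b)

  advanceRow-empty : ∀ y lo f a b → advanceRow y lo 0 f a b ≡ f a b
  advanceRow-empty y lo f a b rewrite inRange-empty lo a with b ≡ᵇ y
  ... | true = refl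
  ... | false = refl

  advanceCol-empty : ∀ x lo f a b → advanceCol x lo 0 f a b ≡ f a b
  advanceCol-empty x lo f a b rewrite inRange-empty lo b with a ≡ᵇ x
  ... | true = refl
  ... | false = refl

  runEast : ∀ n {s j y f} → s ≈ ((j , y) , f) → j + n ≤ k →
    (∀ i → i < n → dir (j + i) (f (j + i) y) ≡ dE) →
    run s n ≈ ((wrap (j + n) , y) , advanceRow y j n f)
  runEast zero {j = j} {y} {f} e jn _ =
    ≈-table (≈-pos e (cong (_, y) (sym (trans (cong wrap (+-identityʳ j)) (wrap-lt (proj₁ (in-square e)))))))
            (λ a b _ _ → sym (advanceRow-empty y j f a b))
  runEast (suc n) {s} {j} {y} {f} e jn east-path =
    ≈-table (≈-pos (mstep≈ previous (trans (cong (dir (j + n)) untouched) (east-path n ≤-refl)))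
                   (cong (λ z → wrap z , y) (sym (+-suc j n))))
            (λ a b _ _ → trans (cong (λ c → advanceIf c (advanceRow y j n f a b)) (∧-comm (a ≡ᵇ j + n) (b ≡ᵇ y)))
                               (advance-extend j n a (b ≡ᵇ y) (f a b)))
    where
    j+n<k : j + n < k
    j+n<k = subst (_≤ k) (+-suc j n) jn
    previous : run s n ≈ ((j + n , y) , advanceRow y j n f)
    previous = ≈-pos (runEast n e (<⇒≤ j+n<k) (λ i i<n → east-path i (m<n⇒m<1+n i<n)))
                     (cong (_, y) (wrap-lt j+n<k))
    untouched : advanceRow y j n f (j + n) y ≡ f (j + n) y
    untouched rewrite inRange-above {j} {n} {j + n} ≤-refl with y ≡ᵇ y
    ... | true = refl
    ... | false = refl

  runNorth : ∀ n {s x j f} → s ≈ ((x , j) , f) → j + n ≤ k →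
    (∀ i → i < n → dir x (f x (j + i)) ≡ dN) →
    run s n ≈ ((x , wrap (j + n)) , advanceCol x j n f)
  runNorth zero {x = x} {j} {f} e jn _ =
    ≈-table (≈-pos e (cong (x ,_) (sym (trans (cong wrap (+-identityʳ j)) (wrap-lt (proj₂ (in-square e)))))))
            (λ a b _ _ → sym (advanceCol-empty x j f a b))
  runNorth (suc n) {s} {x} {j} {f} e jn north-path =
    ≈-table (≈-pos (mstep≈ previous (trans (cong (dir x) untouched) (north-path n ≤-refl)))
                   (cong (λ z → x , wrap z) (sym (+-suc j n))))
            (λ a b _ _ → advance-extend j n b (a ≡ᵇ x) (f a b))
    where
    j+n<k : j + n < k
    j+n<k = subst (_≤ k) (+-suc j n) jn
    previous : run s n ≈ ((x , j + n) , advanceCol x j n f)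
    previous = ≈-pos (runNorth n e (<⇒≤ j+n<k) (λ i i<n → north-path i (m<n⇒m<1+n i<n)))
                     (cong (x ,_) (wrap-lt j+n<k))
    untouched : advanceCol x j n f x (j + n) ≡ f x (j + n)
    untouched rewrite inRange-above {j} {n} {j + n} ≤-refl with x ≡ᵇ x
    ... | true = refl
    ... | false = refl

  bump-other-col : ∀ f {x y a} b → a ≢ x → bump f (x , y) a b ≡ f a b
  bump-other-col f {x} {y} {a} b ne rewrite ≡ᵇ-false ne = refl

  bump-other-row : ∀ f {x y} a {b} → b ≢ y → bump f (x , y) a b ≡ f a b
  bump-other-row f {x} {y} a {b} ne rewrite ≡ᵇ-false ne with a ≡ᵇ x
  ... | true = refl
  ... | false = refl

  private
    shifted-≢ : ∀ lo {i n} → i < n → suc lo + i ≢ suc lo + n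
    shifted-≢ lo i<n e = <-irrefl (+-cancelˡ-≡ (suc lo) _ _ e) i<n

  runWest : ∀ n {s lo y f} → s ≈ ((lo + n , y) , f) →
    (∀ i → i < n → dir (suc lo + i) (f (suc lo + i) y) ≡ dW) →
    run s n ≈ ((lo , y) , advanceRow y (suc lo) n f)
  runWest zero {lo = lo} {y} {f} e _ =
    ≈-table (≈-pos e (cong (_, y) (+-identityʳ lo))) (λ a b _ _ → sym (advanceRow-empty y (suc lo) f a b))
  runWest (suc n) {s} {lo} {y} {f} e west-path rewrite run-suc s n =
    ≈-table (runWest n first-step rest-west) extend
    where
    first-step : mstep s ≈ ((lo + n , y) , bump f (suc lo + n , y))
    first-step = mstep≈ (≈-pos e (cong (_, y) (+-suc lo n))) (west-path n ≤-refl)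
    rest-west : ∀ i → i < n → dir (suc lo + i) (bump f (suc lo + n , y) (suc lo + i) y) ≡ dW
    rest-west i i<n =
      trans (cong (dir (suc lo + i)) (bump-other-col f y (shifted-≢ lo i<n))) (west-path i (m<n⇒m<1+n i<n))
    extend : ∀ a b → a < k → b < k →
      advanceRow y (suc lo) n (bump f (suc lo + n , y)) a b ≡ advanceRow y (suc lo) (suc n) f a b
    extend a b _ _ =
      trans (advanceIf-comm ((b ≡ᵇ y) ∧ inRange (suc lo) n a) ((a ≡ᵇ suc lo + n) ∧ (b ≡ᵇ y)) (f a b))
        (trans (cong (λ c → advanceIf c (advanceIf ((b ≡ᵇ y) ∧ inRange (suc lo) n a) (f a b)))
                     (∧-comm (a ≡ᵇ suc lo + n) (b ≡ᵇ y)))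
               (advance-extend (suc lo) n a (b ≡ᵇ y) (f a b)))

  runSouth : ∀ n {s x lo f} → s ≈ ((x , lo + n) , f) →
    (∀ i → i < n → dir x (f x (suc lo + i)) ≡ dS) →
    run s n ≈ ((x , lo) , advanceCol x (suc lo) n f)
  runSouth zero {x = x} {lo} {f} e _ =
    ≈-table (≈-pos e (cong (x ,_) (+-identityʳ lo))) (λ a b _ _ → sym (advanceCol-empty x (suc lo) f a b))
  runSouth (suc n) {s} {x} {lo} {f} e south-path rewrite run-suc s n =
    ≈-table (runSouth n first-step rest-south) extend
    where
    first-step : mstep s ≈ ((x , lo + n) , bump f (x , suc lo + n))
    first-step = mstep≈ (≈-pos e (cong (x ,_) (+-suc lo n))) (south-path n ≤-refl)
    rest-south : ∀ i → i < n → dir x (bump f (x , suc lo + n) x (suc lo + i)) ≡ dS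
    rest-south i i<n =
      trans (cong (dir x) (bump-other-row f x (shifted-≢ lo i<n))) (south-path i (m<n⇒m<1+n i<n))
    extend : ∀ a b → a < k → b < k →
      advanceCol x (suc lo) n (bump f (x , suc lo + n)) a b ≡ advanceCol x (suc lo) (suc n) f a b
    extend a b _ _ =
      trans (advanceIf-comm ((a ≡ᵇ x) ∧ inRange (suc lo) n b) ((a ≡ᵇ x) ∧ (b ≡ᵇ suc lo + n)) (f a b))
            (advance-extend (suc lo) n b (a ≡ᵇ x) (f a b))

  advanceColumn-here : ∀ x f b → advanceColumn x f x b ≡ advance (f x b)
  advanceColumn-here x f b rewrite ≡ᵇ-true {x} refl = refl

  lapNorth : ∀ {s x f} → s ≈ ((x , 0) , f) → (∀ b → b < k → dir x (f x b) ≡ dN) →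
    run s k ≈ ((x , 0) , advanceColumn x f)
  lapNorth {x = x} {f} e north =
    ≈-table (≈-pos (runNorth k e ≤-refl north) (cong (x ,_) wrap-k)) whole-column
    where
    whole-column : ∀ a b → a < k → b < k → advanceCol x 0 k f a b ≡ advanceColumn x f a b
    whole-column a b _ b<k rewrite inRange-true {0} {k} {b} z≤n b<k with a ≡ᵇ x
    ... | true = refl
    ... | false = refl

  lapSouth : ∀ {s x f} → s ≈ ((x , 0) , f) → (∀ b → b < k → dir x (f x b) ≡ dS) →
    run s k ≈ ((x , 0) , advanceColumn x f)
  lapSouth {s} {x} {f} e south =
    subst (λ n → run s n ≈ ((x , 0) , advanceColumn x f)) k-1+1≡k lap
    where
    k-1+1≡k : suc (pred k) ≡ k
    k-1+1≡k = suc-pred k {{>-nonZero (proj₂ (in-square e))}}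
    lap : run s (suc (pred k)) ≈ ((x , 0) , advanceColumn x f)
    lap rewrite run-suc s (pred k) =
      ≈-table (runSouth (pred k) {lo = 0} (mstep≈ e (south 0 (proj₂ (in-square e)))) rest) whole-column
      where
      rest : ∀ i → i < pred k → dir x (bump f (x , 0) x (suc i)) ≡ dS
      rest i i<k = trans (cong (dir x) (bump-other-row f {x} {0} x {suc i} (λ ())))
                         (south (suc i) (subst (suc i <_) k-1+1≡k (s≤s i<k)))
      whole-column : ∀ a b → a < k → b < k → advanceCol x 1 (pred k) (bump f (x , 0)) a b ≡ advanceColumn x f a b
      whole-column a b _ b<k with a ≡ᵇ x
      ... | false = refl
      whole-column a zero _ _ | true rewrite inRange-below {1} {pred k} {0} (s≤s z≤n) = refl
      whole-column a (suc b) _ b<k | true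
        rewrite inRange-true {1} {pred k} {suc b} (s≤s z≤n) (subst (suc b <_) (sym k-1+1≡k) b<k) = refl

  -- It lasts 2k + 1 steps; each explored side column is toured once per phase.
  tourTime : ℕ
  tourTime = k + (k + 1)

  columnTour : ∀ {s c f} → dir c q1 ≡ dN → dir c q2 ≡ dS → (∀ b → f c b ≡ q1) → s ≈ ((c , 0) , f) →
    run s tourTime ≈ (move (dir c q3) (c , 0) , bump (advanceColumn c (advanceColumn c f)) (c , 0))
  columnTour {c = c} {f} q1-north q2-south column-q1 e =
    chain k (k + 1) (lapNorth e (λ b _ → trans (cong (dir c) (column-q1 b)) q1-north)) λ e₁ →
    chain k 1 (lapSouth e₁ (λ b _ → trans (cong (dir c) (trans (advanceColumn-here c f b)
                                                                (cong advance (column-q1 b)))) q2-south)) λ e₂ →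
    mstep≈ e₂ (cong (dir c) (trans (advanceColumn-here c (advanceColumn c f) 0)
                                  (cong advance (trans (advanceColumn-here c f 0) (cong advance (column-q1 0))))))

  sweepTime : ℕ → ℕ
  sweepTime r = (suc r + suc r) + ((1 + (r + suc r)) + 1)

  phaseTime : ℕ → ℕ
  phaseTime r = k + (1 + (r * tourTime + ((suc r + 1) + (r * tourTime + ((suc r + 1) + pred k * sweepTime r)))))

  -- The table at the start of phase r: columns within distance r of column 0 (i.e.
  -- 0..r and k-r..k-1) are in state q1, all others are fresh.
  exploredTable : ℕ → Table
  exploredTable r a b = if (a <ᵇ suc r) ∨ not (a <ᵇ k ∸ r) then q1 else fresh

  -- The regions of phase r: Z = column 0, RI = right interior 1..r, RF = right frontier
  -- r+1, O = unexplored, LF = left frontier lf = k-r-1, LI = left interior lf+1..k-1.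
  data Region : Set where
    Z RI RF O LF LI : Region

  isZ isRI isRF isLF isLI : Region → Bool
  isZ Z = true
  isZ _ = false
  isRI RI = true
  isRI _ = false
  isRF RF = true
  isRF _ = false
  isLF LF = true
  isLF _ = false
  isLI LI = true
  isLI _ = false

  -- Phase r, for r < R; lf = k - r - 1 is the left frontier column.  The hypotheses
  -- guarantee that the right frontier uses `rightDir` and the left frontier `leftDir`.
  module Phase (r lf : ℕ) (lf+r+1≡k : lf + suc r ≡ k) (r<R : suc r ≤ R) (R<lf : R < lf) where

    r+1<lf : suc r < lf
    r+1<lf = <-≤-trans (s≤s r<R) R<lf

    lf<k : lf < k
    lf<k = subst (lf <_) lf+r+1≡k (m<m+n lf (s≤s z≤n))

    r+1<k : suc r < k
    r+1<k = <-trans r+1<lf lf<k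

    data RegionOf (a : ℕ) : Region → Set where
      inZ  : a ≡ 0 → RegionOf a Z
      inRI : 0 < a → a < suc r → RegionOf a RI
      inRF : a ≡ suc r → RegionOf a RF
      inO  : suc r < a → a < lf → RegionOf a O
      inLF : a ≡ lf → RegionOf a LF
      inLI : lf < a → a < k → RegionOf a LI

    opaque
      region : ℕ → Region
      region a = if a ≡ᵇ 0 then Z else if a <ᵇ suc r then RI else if a ≡ᵇ suc r then RF
                 else if a <ᵇ lf then O else if a ≡ᵇ lf then LF else LI

      regionOf : ∀ a → a < k → RegionOf a (region a)
      regionOf a a<k with a ≡ᵇ 0 | ≡ᵇ-reflects-≡ a 0
      ... | true | ofʸ e = inZ e
      ... | false | ofⁿ a≢0 with a <ᵇ suc r | <ᵇ-reflects-< a (suc r)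
      ...   | true | ofʸ lt = inRI (n≢0⇒n>0 a≢0) lt
      ...   | false | ofⁿ ge with a ≡ᵇ suc r | ≡ᵇ-reflects-≡ a (suc r)
      ...     | true | ofʸ e = inRF e
      ...     | false | ofⁿ ne with a <ᵇ lf | <ᵇ-reflects-< a lf
      ...       | true | ofʸ lt = inO (≤∧≢⇒< (≮⇒≥ ge) (ne ∘ sym)) lt
      ...       | false | ofⁿ ge′ with a ≡ᵇ lf | ≡ᵇ-reflects-≡ a lf
      ...         | true | ofʸ e = inLF e
      ...         | false | ofⁿ ne′ = inLI (≤∧≢⇒< (≮⇒≥ ge′) (ne′ ∘ sym)) a<k

      region-Z : region 0 ≡ Z
      region-Z = refl

      region-RI : ∀ {a} → 0 < a → a < suc r → region a ≡ RI
      region-RI {a} 0<a a≤r rewrite ≡ᵇ-false {a} {0} (>⇒≢ 0<a) | <ᵇ-true a≤r = refl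

      region-RF : region (suc r) ≡ RF
      region-RF rewrite <ᵇ-false {r} {r} ≤-refl | ≡ᵇ-true {r} refl = refl

      region-LF : region lf ≡ LF
      region-LF rewrite ≡ᵇ-false {lf} {0} (>⇒≢ (<-trans z<s r+1<lf))
                      | <ᵇ-false {lf} {suc r} (<⇒≤ r+1<lf) | ≡ᵇ-false {lf} {suc r} (>⇒≢ r+1<lf)
                      | <ᵇ-false {lf} {lf} ≤-refl | ≡ᵇ-true {lf} refl = refl

      region-LI : ∀ {a} → lf < a → region a ≡ LI
      region-LI {a} lf<a rewrite ≡ᵇ-false {a} {0} (>⇒≢ (<-trans z<s (<-trans r+1<lf lf<a)))
                                | <ᵇ-false {a} {suc r} (<⇒≤ (<-trans r+1<lf lf<a))
                                | ≡ᵇ-false {a} {suc r} (>⇒≢ (<-trans r+1<lf lf<a))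
                                | <ᵇ-false {a} {lf} (<⇒≤ lf<a) | ≡ᵇ-false {a} {lf} (>⇒≢ lf<a) = refl

    test-Z : ∀ {a g} → RegionOf a g → (a ≡ᵇ 0) ≡ isZ g
    test-Z (inZ refl) = refl
    test-Z (inRI 0<a _) = ≡ᵇ-false (>⇒≢ 0<a)
    test-Z (inRF refl) = refl
    test-Z (inO lt _) = ≡ᵇ-false (>⇒≢ (<-trans z<s lt))
    test-Z (inLF refl) = ≡ᵇ-false (>⇒≢ (<-trans z<s r+1<lf))
    test-Z (inLI lt _) = ≡ᵇ-false (>⇒≢ (≤-trans (s≤s z≤n) lt))

    test-Z∨RI : ∀ {a g} → RegionOf a g → inRange 0 (suc r) a ≡ (isZ g ∨ isRI g)
    test-Z∨RI (inZ refl) = inRange-true z≤n z<s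
    test-Z∨RI (inRI _ lt) = inRange-true z≤n lt
    test-Z∨RI (inRF refl) = inRange-above ≤-refl
    test-Z∨RI (inO lt _) = inRange-above (<⇒≤ lt)
    test-Z∨RI (inLF refl) = inRange-above (<⇒≤ r+1<lf)
    test-Z∨RI (inLI lt _) = inRange-above (<⇒≤ (<-trans r+1<lf lt))

    test-RI∨RF : ∀ {a g} → RegionOf a g → inRange 1 (suc r) a ≡ (isRI g ∨ isRF g)
    test-RI∨RF (inZ refl) = inRange-below z<s
    test-RI∨RF (inRI 0<a lt) = inRange-true 0<a (m<n⇒m<1+n lt)
    test-RI∨RF (inRF refl) = inRange-true z<s ≤-refl
    test-RI∨RF (inO lt _) = inRange-above lt
    test-RI∨RF (inLF refl) = inRange-above r+1<lf
    test-RI∨RF (inLI lt _) = inRange-above (<-trans r+1<lf lt)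

    test-LI : ∀ {a g} → RegionOf a g → inRange (suc lf) r a ≡ isLI g
    test-LI (inZ refl) = inRange-below z<s
    test-LI (inRI _ lt) = inRange-below (<-trans lt (<-trans r+1<lf (n<1+n lf)))
    test-LI (inRF refl) = inRange-below (<-trans r+1<lf (n<1+n lf))
    test-LI (inO _ lt) = inRange-below (<-trans lt (n<1+n lf))
    test-LI (inLF refl) = inRange-below (n<1+n lf)
    test-LI (inLI lt a<k) = inRange-true lt (subst (_ <_) (sym (trans (sym (+-suc lf r)) lf+r+1≡k)) a<k)

    test-LF∨LI : ∀ {a g} → RegionOf a g → inRange lf (suc r) a ≡ (isLF g ∨ isLI g)
    test-LF∨LI (inZ refl) = inRange-below (<-trans z<s r+1<lf)
    test-LF∨LI (inRI _ lt) = inRange-below (<-trans lt r+1<lf)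
    test-LF∨LI (inRF refl) = inRange-below r+1<lf
    test-LF∨LI (inO _ lt) = inRange-below lt
    test-LF∨LI (inLF refl) = inRange-true ≤-refl (m<m+n lf z<s)
    test-LF∨LI (inLI lt a<k) = inRange-true (<⇒≤ lt) (subst (_ <_) (sym lf+r+1≡k) a<k)

    dir-right : ∀ c → c ≤ r → dir (suc c) ≡ rightDir
    dir-right c c≤r rewrite <ᵇ-true {c} {R} (≤-trans (s≤s c≤r) r<R) = refl

    dir-left : ∀ a → lf ≤ a → dir a ≡ leftDir
    dir-left zero lf≤0 = ⊥-elim (<⇒≱ (<-trans z<s r+1<lf) lf≤0)
    dir-left (suc a) lf≤a rewrite <ᵇ-false {a} {R} (≤-pred (≤-trans R<lf lf≤a)) = refl

    startRotor endRotor : Region → Rotor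
    startRotor Z = q1
    startRotor RI = q1
    startRotor RF = fresh
    startRotor O = fresh
    startRotor LF = fresh
    startRotor LI = q1
    endRotor O = fresh
    endRotor _ = q1

    k∸r≡lf+1 : k ∸ r ≡ suc lf
    k∸r≡lf+1 = trans (cong (_∸ r) (trans (sym lf+r+1≡k) (+-suc lf r))) (m+n∸n≡m (suc lf) r)

    k∸r+1≡lf : k ∸ suc r ≡ lf
    k∸r+1≡lf = trans (cong (_∸ suc r) (sym lf+r+1≡k)) (m+n∸n≡m lf (suc r))

    exploredTable-start : ∀ a b → a < k → exploredTable r a b ≡ startRotor (region a)
    exploredTable-start a b a<k rewrite k∸r≡lf+1 with region a | regionOf a a<k
    ... | Z | inZ refl = refl
    ... | RI | inRI _ lt rewrite <ᵇ-true lt = refl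
    ... | RF | inRF refl rewrite <ᵇ-false {suc r} {suc r} ≤-refl
                               | <ᵇ-true {suc r} {suc lf} (<-trans r+1<lf (n<1+n lf)) = refl
    ... | O | inO lt lt′ rewrite <ᵇ-false {a} {suc r} (<⇒≤ lt) | <ᵇ-true {a} {suc lf} (m<n⇒m<1+n lt′) = refl
    ... | LF | inLF refl rewrite <ᵇ-false {lf} {suc r} (<⇒≤ r+1<lf) | <ᵇ-true {lf} {suc lf} ≤-refl = refl
    ... | LI | inLI lt _ rewrite <ᵇ-false {a} {suc r} (<⇒≤ (<-trans r+1<lf lt)) | <ᵇ-false {a} {suc lf} lt = refl

    exploredTable-end : ∀ a b → a < k → exploredTable (suc r) a b ≡ endRotor (region a)
    exploredTable-end a b a<k rewrite k∸r+1≡lf with region a | regionOf a a<k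
    ... | Z | inZ refl = refl
    ... | RI | inRI _ lt rewrite <ᵇ-true {a} {suc (suc r)} (m<n⇒m<1+n lt) = refl
    ... | RF | inRF refl rewrite <ᵇ-true {suc r} {suc (suc r)} ≤-refl = refl
    ... | O | inO lt lt′ rewrite <ᵇ-false {a} {suc (suc r)} lt | <ᵇ-true lt′ = refl
    ... | LF | inLF refl rewrite <ᵇ-false {lf} {suc (suc r)} r+1<lf | <ᵇ-false {lf} {lf} ≤-refl = refl
    ... | LI | inLI lt _ rewrite <ᵇ-false {a} {suc (suc r)} (<-trans r+1<lf lt) | <ᵇ-false {a} {lf} (<⇒≤ lt) = refl

    lf+r≡k-1 : pred k ≡ lf + r
    lf+r≡k-1 = trans (cong pred (sym lf+r+1≡k)) (cong pred (+-suc lf r))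

    -- Stage 1: the centre column (state q1, south) is lapped once and turns to q2 (east).
    centreLapRotor : Region → Rotor
    centreLapRotor Z = q2
    centreLapRotor g = startRotor g

    centreLapTable : Table
    centreLapTable a b = centreLapRotor (region a)

    centreLap : ∀ {s} → s ≈ ((0 , 0) , exploredTable r) → run s k ≈ ((0 , 0) , centreLapTable)
    centreLap e = ≈-table (lapSouth e (λ _ _ → refl)) agree
      where
      agree : ∀ a b → a < k → b < k → advanceColumn 0 (exploredTable r) a b ≡ centreLapTable a b
      agree a b a<k _ rewrite exploredTable-start a b a<k | test-Z (regionOf a a<k) with region a
      ... | Z = refl
      ... | RI = refl
      ... | RF = refl
      ... | O = refl
      ... | LF = refl
      ... | LI = refl

    -- Stage 2: the walk leaves the centre eastwards and tours the right columns
    -- 1, 2, …, r in turn.  `rightTourTable c` is the table when the walk stands at (c, 0):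
    -- toured columns are in q3, except row 0 which has already sent the walk east (q0).
    rightTourRotor : ℕ → ℕ → ℕ → Region → Rotor
    rightTourRotor c a b Z = if b ≡ᵇ 0 then q3 else q2
    rightTourRotor c a b RI = if a <ᵇ c then (if b ≡ᵇ 0 then q0 else q3) else q1
    rightTourRotor c a b RF = fresh
    rightTourRotor c a b O = fresh
    rightTourRotor c a b LF = fresh
    rightTourRotor c a b LI = q1

    rightTourTable : ℕ → Table
    rightTourTable c a b = rightTourRotor c a b (region a)

    leaveCentreEast : ∀ {s} → s ≈ ((0 , 0) , centreLapTable) → run s 1 ≈ ((1 , 0) , rightTourTable 1)
    leaveCentreEast e =
      ≈-table (≈-pos (mstep≈ e (cong (λ g → dir 0 (centreLapRotor g)) region-Z))
                     (cong (_, 0) (wrap-lt (≤-trans (s≤s (s≤s z≤n)) r+1<k)))) agree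
      where
      agree : ∀ a b → a < k → b < k → bump centreLapTable (0 , 0) a b ≡ rightTourTable 1 a b
      agree a b a<k _ rewrite test-Z (regionOf a a<k) with region a | regionOf a a<k
      ... | Z | inZ _ with b ≡ᵇ 0
      ...   | true = refl
      ...   | false = refl
      agree a b a<k _ | RI | inRI 0<a _ rewrite <ᵇ-false {a} {1} 0<a = refl
      agree a b a<k _ | RF | _ = refl
      agree a b a<k _ | O | _ = refl
      agree a b a<k _ | LF | _ = refl
      agree a b a<k _ | LI | _ = refl

    <ᵇ-suc : ∀ {a c} → a ≢ c → (a <ᵇ suc c) ≡ (a <ᵇ c)
    <ᵇ-suc {a} {c} a≢c with a <ᵇ c | <ᵇ-reflects-< a c
    ... | true | ofʸ lt = <ᵇ-true (m<n⇒m<1+n lt)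
    ... | false | ofⁿ ¬lt = <ᵇ-false (≤∧≢⇒< (≮⇒≥ ¬lt) (a≢c ∘ sym))

    rightTour : ∀ {s c} → 0 < c → c < suc r → s ≈ ((c , 0) , rightTourTable c) →
      run s tourTime ≈ ((suc c , 0) , rightTourTable (suc c))
    rightTour {s} {suc c′} 0<c c≤r e =
      ≈-table (≈-pos (columnTour (cong (_$ q1) right) (cong (_$ q2) right) column-q1 e)
                     (cong (λ d → move (d q3) (c , 0)) right ⟨ trans ⟩ cong (_, 0) (wrap-lt (≤-<-trans c≤r r+1<k))))
              agree
      where
      c = suc c′
      right : dir c ≡ rightDir
      right = dir-right c′ (<⇒≤ (≤-pred c≤r))
      in-RI : region c ≡ RI
      in-RI = region-RI 0<c c≤r
      column-q1 : ∀ b → rightTourTable c c b ≡ q1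
      column-q1 b rewrite in-RI | <ᵇ-false {c} {c} ≤-refl = refl
      agree : ∀ a b → a < k → b < k →
        bump (advanceColumn c (advanceColumn c (rightTourTable c))) (c , 0) a b ≡ rightTourTable (suc c) a b
      agree a b a<k _ with a ≡ᵇ c | ≡ᵇ-reflects-≡ a c
      ... | true | ofʸ refl rewrite in-RI | <ᵇ-false {a} {a} ≤-refl | <ᵇ-true {a} {suc a} ≤-refl with b ≡ᵇ 0
      ...   | true = refl
      ...   | false = refl
      agree a b a<k _ | false | ofⁿ a≢c with region a
      ... | Z = refl
      ... | RI rewrite <ᵇ-suc a≢c = refl
      ... | RF = refl
      ... | O = refl
      ... | LF = refl
      ... | LI = refl

    rightTours : ∀ i {s c} → 0 < c → c + i ≡ suc r → s ≈ ((c , 0) , rightTourTable c) →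
      run s (i * tourTime) ≈ ((suc r , 0) , rightTourTable (suc r))
    rightTours zero {c = c} _ c≡r+1 e rewrite +-identityʳ c | c≡r+1 = e
    rightTours (suc i) {c = c} 0<c c+i≡r+1 e =
      chain tourTime (i * tourTime) (rightTour 0<c c≤r e) λ e′ →
      rightTours i z<s (trans (sym (+-suc c i)) c+i≡r+1) e′
      where
      c≤r : c < suc r
      c≤r = subst (c <_) c+i≡r+1 (m<m+n c z<s)

    -- Stage 3: the fresh right frontier sends the walk back along row 0 to the centre,
    -- which now sends it west into column k - 1 = lf + r; the walk then tours the left
    -- columns lf + r, …, lf + 1.  `leftTourTable j` is the table when it stands at
    -- (lf + j, 0).
    leftTourRotor : ℕ → ℕ → ℕ → Region → Rotor
    leftTourRotor j a b Z = if b ≡ᵇ 0 then q0 else q2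
    leftTourRotor j a b RI = if b ≡ᵇ 0 then q1 else q3
    leftTourRotor j a b RF = if b ≡ᵇ 0 then q1 else fresh
    leftTourRotor j a b O = fresh
    leftTourRotor j a b LF = fresh
    leftTourRotor j a b LI = if lf + j <ᵇ a then (if b ≡ᵇ 0 then q0 else q3) else q1

    leftTourTable : ℕ → Table
    leftTourTable j a b = leftTourRotor j a b (region a)

    crossToLeft : ∀ {s} → s ≈ ((suc r , 0) , rightTourTable (suc r)) →
      run s (suc r + 1) ≈ ((lf + r , 0) , leftTourTable r)
    crossToLeft e =
      chain (suc r) 1 (runWest (suc r) {lo = 0} e west-row) λ e′ →
      ≈-table (≈-pos (mstep≈ e′ centre-west) (cong (_, 0) lf+r≡k-1)) agree
      where
      west-row : ∀ i → i < suc r → dir (suc i) (rightTourTable (suc r) (suc i) 0) ≡ dW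
      west-row i i≤r rewrite dir-right i (≤-pred i≤r) with i ≡ᵇ r | ≡ᵇ-reflects-≡ i r
      ... | true | ofʸ refl rewrite region-RF = refl
      ... | false | ofⁿ i≢r rewrite region-RI {suc i} z<s (s≤s (≤∧≢⇒< (≤-pred i≤r) i≢r))
                                 | <ᵇ-true {i} {r} (≤∧≢⇒< (≤-pred i≤r) i≢r) = refl
      centre-west : dir 0 (advanceRow 0 1 (suc r) (rightTourTable (suc r)) 0 0) ≡ dW
      centre-west rewrite inRange-below {1} {suc r} {0} z<s | region-Z = refl
      agree : ∀ a b → a < k → b < k →
        bump (advanceRow 0 1 (suc r) (rightTourTable (suc r))) (0 , 0) a b ≡ leftTourTable r a b
      agree a b a<k _ rewrite test-Z (regionOf a a<k) | test-RI∨RF (regionOf a a<k) with region a | regionOf a a<k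
      ... | Z | _ with b ≡ᵇ 0
      ...   | true = refl
      ...   | false = refl
      agree a b a<k _ | RI | inRI _ lt rewrite <ᵇ-true lt with b ≡ᵇ 0
      ...   | true = refl
      ...   | false = refl
      agree a b a<k _ | RF | _ with b ≡ᵇ 0
      ...   | true = refl
      ...   | false = refl
      agree a b a<k _ | O | _ with b ≡ᵇ 0
      ...   | true = refl
      ...   | false = refl
      agree a b a<k _ | LF | _ with b ≡ᵇ 0
      ...   | true = refl
      ...   | false = refl
      agree a b a<k _ | LI | inLI _ a<k′
        rewrite <ᵇ-false {lf + r} {a} (≤-pred (subst (a <_) (trans (sym lf+r+1≡k) (+-suc lf r)) a<k′)) with b ≡ᵇ 0
      ...   | true = refl
      ...   | false = refl

    <ᵇ-suc-left : ∀ {a j} → a ≢ lf + suc j → (lf + suc j <ᵇ a) ≡ (lf + j <ᵇ a)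
    <ᵇ-suc-left {a} {j} ne rewrite +-suc lf j with lf + j <ᵇ a | <ᵇ-reflects-< (lf + j) a
    ... | true | ofʸ lt = <ᵇ-true (≤∧≢⇒< lt (ne ∘ sym))
    ... | false | ofⁿ ¬lt = <ᵇ-false (≤-trans (≮⇒≥ ¬lt) (n≤1+n _))

    leftTour : ∀ {s j} → suc j ≤ r → s ≈ ((lf + suc j , 0) , leftTourTable (suc j)) →
      run s tourTime ≈ ((lf + j , 0) , leftTourTable j)
    leftTour {s} {j} j<r e =
      ≈-table (≈-pos (columnTour (cong (_$ q1) left) (cong (_$ q2) left) column-q1 e)
                     (cong (λ d → move (d q3) (c , 0)) left ⟨ trans ⟩ cong (λ x → west x , 0) (+-suc lf j)))
              agree
      where
      c = lf + suc j
      left : dir c ≡ leftDir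
      left = dir-left c (m≤m+n lf (suc j))
      in-LI : region c ≡ LI
      in-LI = region-LI (m<m+n lf z<s)
      column-q1 : ∀ b → leftTourTable (suc j) c b ≡ q1
      column-q1 b rewrite in-LI | <ᵇ-false {c} {c} ≤-refl = refl
      agree : ∀ a b → a < k → b < k →
        bump (advanceColumn c (advanceColumn c (leftTourTable (suc j)))) (c , 0) a b ≡ leftTourTable j a b
      agree a b a<k _ with a ≡ᵇ c | ≡ᵇ-reflects-≡ a c
      ... | true | ofʸ refl rewrite in-LI | <ᵇ-false {a} {a} ≤-refl
                                  | <ᵇ-true {lf + j} {lf + suc j} (+-monoʳ-< lf (n<1+n j)) with b ≡ᵇ 0
      ...   | true = refl
      ...   | false = refl
      agree a b a<k _ | false | ofⁿ a≢c with region a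
      ... | Z = refl
      ... | RI = refl
      ... | RF = refl
      ... | O = refl
      ... | LF = refl
      ... | LI rewrite <ᵇ-suc-left {a} {j} a≢c = refl

    leftTours : ∀ j {s} → j ≤ r → s ≈ ((lf + j , 0) , leftTourTable j) →
      run s (j * tourTime) ≈ ((lf , 0) , leftTourTable 0)
    leftTours zero _ e rewrite +-identityʳ lf = e
    leftTours (suc j) j<r e =
      chain tourTime (j * tourTime) (leftTour j<r e) λ e′ → leftTours j (<⇒≤ j<r) e′

    -- Stage 4: the fresh left frontier sends the walk east along row 0 back to the centre,
    -- which now points north; then the rows 1, 2, …, k-1 are swept one after the other.
    -- `sweepTable y` is the table when the walk reaches (0, y): rows below y are
    -- finished (`endRotor`), the other rows are still `pendingRotor`.
    pendingRotor : Region → Rotor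
    pendingRotor Z = q2
    pendingRotor RI = q3
    pendingRotor RF = fresh
    pendingRotor O = fresh
    pendingRotor LF = fresh
    pendingRotor LI = q3

    sweepTable : ℕ → Table
    sweepTable y a b = if b <ᵇ y then endRotor (region a) else pendingRotor (region a)

    wrap-lf+r+1 : wrap (lf + suc r) ≡ 0
    wrap-lf+r+1 = trans (cong wrap lf+r+1≡k) wrap-k

    returnToCentre : ∀ {s} → s ≈ ((lf , 0) , leftTourTable 0) → run s (suc r + 1) ≈ ((0 , wrap 1) , sweepTable 1)
    returnToCentre e =
      chain (suc r) 1 (≈-pos (runEast (suc r) e (≤-reflexive lf+r+1≡k) east-row) (cong (_, 0) wrap-lf+r+1)) λ e′ →
      ≈-table (mstep≈ e′ centre-north) agree
      where
      east-row : ∀ i → i < suc r → dir (lf + i) (leftTourTable 0 (lf + i) 0) ≡ dE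
      east-row zero _ rewrite dir-left (lf + 0) (m≤m+n lf 0) | +-identityʳ lf | region-LF = refl
      east-row (suc i) _ rewrite dir-left (lf + suc i) (m≤m+n lf (suc i)) | region-LI {lf + suc i} (m<m+n lf z<s)
                               | <ᵇ-true {lf + 0} {lf + suc i} (+-monoʳ-< lf z<s) = refl
      centre-north : dir 0 (advanceRow 0 lf (suc r) (leftTourTable 0) 0 0) ≡ dN
      centre-north rewrite inRange-below {lf} {suc r} {0} (<-trans z<s r+1<lf) | region-Z = refl
      agree : ∀ a b → a < k → b < k → bump (advanceRow 0 lf (suc r) (leftTourTable 0)) (0 , 0) a b ≡ sweepTable 1 a b
      agree a b a<k _ rewrite test-Z (regionOf a a<k) | test-LF∨LI (regionOf a a<k) with region a | regionOf a a<k | b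
      ... | Z | _ | zero = refl
      ... | Z | _ | suc _ = refl
      ... | RI | _ | zero = refl
      ... | RI | _ | suc _ = refl
      ... | RF | _ | zero = refl
      ... | RF | _ | suc _ = refl
      ... | O | _ | zero = refl
      ... | O | _ | suc _ = refl
      ... | LF | _ | zero = refl
      ... | LF | _ | suc _ = refl
      ... | LI | inLI lt _ | zero rewrite <ᵇ-true {lf + 0} {a} (subst (_< a) (sym (+-identityʳ lf)) lt) = refl
      ... | LI | inLI lt _ | suc _ rewrite <ᵇ-true {lf + 0} {a} (subst (_< a) (sym (+-identityʳ lf)) lt) = refl

    withRow : ℕ → (Region → Rotor) → Table
    withRow y ρ a b = if b <ᵇ y then endRotor (region a) else if b ≡ᵇ y then ρ (region a) else pendingRotor (region a)

    withRow-row : ∀ y ρ a → withRow y ρ a y ≡ ρ (region a)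
    withRow-row y ρ a rewrite <ᵇ-false {y} {y} ≤-refl | ≡ᵇ-true {y} refl = refl

    sweep-withRow : ∀ y a b → sweepTable y a b ≡ withRow y pendingRotor a b
    sweep-withRow y a b with b <ᵇ y
    ... | true = refl
    ... | false with b ≡ᵇ y
    ...   | true = refl
    ...   | false = refl

    withRow-sweep : ∀ y a b → withRow y endRotor a b ≡ sweepTable (suc y) a b
    withRow-sweep y a b with b ≡ᵇ y | ≡ᵇ-reflects-≡ b y
    ... | true | ofʸ refl rewrite <ᵇ-false {b} {b} ≤-refl | <ᵇ-true {b} {suc b} ≤-refl = refl
    ... | false | ofⁿ b≢y rewrite <ᵇ-suc b≢y = refl

    advanceRow-withRow : ∀ y lo n ρ σ →
      (∀ a → a < k → advanceIf (inRange lo n a) (ρ (region a)) ≡ σ (region a)) →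
      ∀ a b → a < k → b < k → advanceRow y lo n (withRow y ρ) a b ≡ withRow y σ a b
    advanceRow-withRow y lo n ρ σ on-row a b a<k _ with b ≡ᵇ y | ≡ᵇ-reflects-≡ b y
    ... | true | ofʸ refl rewrite <ᵇ-false {b} {b} ≤-refl = on-row a a<k
    ... | false | ofⁿ _ = refl

    bump-withRow : ∀ y ρ σ → (∀ a → a < k → advanceIf (a ≡ᵇ 0) (ρ (region a)) ≡ σ (region a)) →
      ∀ a b → a < k → b < k → bump (withRow y ρ) (0 , y) a b ≡ withRow y σ a b
    bump-withRow y ρ σ on-row a b a<k _ with b ≡ᵇ y | ≡ᵇ-reflects-≡ b y
    ... | true | ofʸ refl rewrite <ᵇ-false {b} {b} ≤-refl | ∧-identityʳ (a ≡ᵇ 0) = on-row a a<k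
    ... | false | ofⁿ _ rewrite ∧-zeroʳ (a ≡ᵇ 0) = refl

    afterRightRotor : Region → Rotor
    afterRightRotor Z = q3
    afterRightRotor RI = q1
    afterRightRotor RF = q1
    afterRightRotor O = fresh
    afterRightRotor LF = fresh
    afterRightRotor LI = q3

    rightExcursion : ∀ {s y} → s ≈ ((0 , y) , withRow y pendingRotor) →
      run s (suc r + suc r) ≈ ((0 , y) , withRow y afterRightRotor)
    rightExcursion {y = y} e =
      chain (suc r) (suc r)
        (≈-table (≈-pos (runEast (suc r) e (<⇒≤ r+1<k) east-row) (cong (_, y) (wrap-lt r+1<k)))
                 (advanceRow-withRow y 0 (suc r) pendingRotor outward outward-row)) λ e′ →
      ≈-table (runWest (suc r) {lo = 0} e′ west-row) (advanceRow-withRow y 1 (suc r) outward afterRightRotor back-row)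
      where
      outward : Region → Rotor
      outward Z = q3
      outward RI = q0
      outward RF = fresh
      outward O = fresh
      outward LF = fresh
      outward LI = q3
      east-row : ∀ i → i < suc r → dir i (withRow y pendingRotor i y) ≡ dE
      east-row zero _ rewrite withRow-row y pendingRotor 0 | region-Z = refl
      east-row (suc i) i≤r rewrite withRow-row y pendingRotor (suc i) | dir-right i (<⇒≤ (≤-pred i≤r))
                                 | region-RI {suc i} z<s i≤r = refl
      outward-row : ∀ a → a < k → advanceIf (inRange 0 (suc r) a) (pendingRotor (region a)) ≡ outward (region a)
      outward-row a a<k rewrite test-Z∨RI (regionOf a a<k) with region a
      ... | Z = refl
      ... | RI = refl
      ... | RF = refl
      ... | O = refl
      ... | LF = refl
      ... | LI = refl
      west-row : ∀ i → i < suc r → dir (suc i) (withRow y outward (suc i) y) ≡ dW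
      west-row i i≤r rewrite withRow-row y outward (suc i) | dir-right i (≤-pred i≤r)
        with i ≡ᵇ r | ≡ᵇ-reflects-≡ i r
      ... | true | ofʸ refl rewrite region-RF = refl
      ... | false | ofⁿ i≢r rewrite region-RI {suc i} z<s (s≤s (≤∧≢⇒< (≤-pred i≤r) i≢r)) = refl
      back-row : ∀ a → a < k → advanceIf (inRange 1 (suc r) a) (outward (region a)) ≡ afterRightRotor (region a)
      back-row a a<k rewrite test-RI∨RF (regionOf a a<k) with region a
      ... | Z = refl
      ... | RI = refl
      ... | RF = refl
      ... | O = refl
      ... | LF = refl
      ... | LI = refl

    afterLeftRotor : Region → Rotor
    afterLeftRotor Z = q0
    afterLeftRotor O = fresh
    afterLeftRotor _ = q1

    leftExcursion : ∀ {s y} → s ≈ ((0 , y) , withRow y afterRightRotor) →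
      run s (1 + (r + suc r)) ≈ ((0 , y) , withRow y afterLeftRotor)
    leftExcursion {y = y} e =
      chain 1 (r + suc r)
        (≈-table (≈-pos (mstep≈ e centre-west) (cong (_, y) lf+r≡k-1))
                 (bump-withRow y afterRightRotor crossed crossed-row)) λ e₁ →
      chain r (suc r)
        (≈-table (runWest r {lo = lf} e₁ west-row) (advanceRow-withRow y (suc lf) r crossed outward outward-row)) λ e₂ →
      ≈-table (≈-pos (runEast (suc r) e₂ (≤-reflexive lf+r+1≡k) east-row) (cong (_, y) wrap-lf+r+1))
              (advanceRow-withRow y lf (suc r) outward afterLeftRotor back-row)
      where
      crossed outward : Region → Rotor
      crossed Z = q0
      crossed g = afterRightRotor g
      outward LI = q0
      outward g = crossed g
      centre-west : dir 0 (withRow y afterRightRotor 0 y) ≡ dW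
      centre-west rewrite withRow-row y afterRightRotor 0 | region-Z = refl
      crossed-row : ∀ a → a < k → advanceIf (a ≡ᵇ 0) (afterRightRotor (region a)) ≡ crossed (region a)
      crossed-row a a<k rewrite test-Z (regionOf a a<k) with region a
      ... | Z = refl
      ... | RI = refl
      ... | RF = refl
      ... | O = refl
      ... | LF = refl
      ... | LI = refl
      west-row : ∀ i → i < r → dir (suc lf + i) (withRow y crossed (suc lf + i) y) ≡ dW
      west-row i _ rewrite withRow-row y crossed (suc lf + i)
                         | dir-left (suc lf + i) (≤-trans (n≤1+n lf) (m≤m+n (suc lf) i))
                         | region-LI {suc lf + i} (s≤s (m≤m+n lf i)) = refl
      outward-row : ∀ a → a < k → advanceIf (inRange (suc lf) r a) (crossed (region a)) ≡ outward (region a)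
      outward-row a a<k rewrite test-LI (regionOf a a<k) with region a
      ... | Z = refl
      ... | RI = refl
      ... | RF = refl
      ... | O = refl
      ... | LF = refl
      ... | LI = refl
      east-row : ∀ i → i < suc r → dir (lf + i) (withRow y outward (lf + i) y) ≡ dE
      east-row zero _ rewrite withRow-row y outward (lf + 0) | dir-left (lf + 0) (m≤m+n lf 0)
                            | +-identityʳ lf | region-LF = refl
      east-row (suc i) _ rewrite withRow-row y outward (lf + suc i) | dir-left (lf + suc i) (m≤m+n lf (suc i))
                               | region-LI {lf + suc i} (m<m+n lf z<s) = refl
      back-row : ∀ a → a < k → advanceIf (inRange lf (suc r) a) (outward (region a)) ≡ afterLeftRotor (region a)
      back-row a a<k rewrite test-LF∨LI (regionOf a a<k) with region a
      ... | Z = refl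
      ... | RI = refl
      ... | RF = refl
      ... | O = refl
      ... | LF = refl
      ... | LI = refl

    climb : ∀ {s y} → s ≈ ((0 , y) , withRow y afterLeftRotor) → run s 1 ≈ ((0 , wrap (suc y)) , sweepTable (suc y))
    climb {y = y} e =
      ≈-table (mstep≈ e centre-north)
              (λ a b a<k b<k → trans (bump-withRow y afterLeftRotor endRotor row a b a<k b<k) (withRow-sweep y a b))
      where
      centre-north : dir 0 (withRow y afterLeftRotor 0 y) ≡ dN
      centre-north rewrite withRow-row y afterLeftRotor 0 | region-Z = refl
      row : ∀ a → a < k → advanceIf (a ≡ᵇ 0) (afterLeftRotor (region a)) ≡ endRotor (region a)
      row a a<k rewrite test-Z (regionOf a a<k) with region a
      ... | Z = refl
      ... | RI = refl
      ... | RF = refl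
      ... | O = refl
      ... | LF = refl
      ... | LI = refl

    sweepRow : ∀ {s y} → s ≈ ((0 , y) , sweepTable y) → run s (sweepTime r) ≈ ((0 , wrap (suc y)) , sweepTable (suc y))
    sweepRow {y = y} e =
      chain (suc r + suc r) _ (rightExcursion (≈-table e (λ a b _ _ → sweep-withRow y a b))) λ e₁ →
      chain (1 + (r + suc r)) 1 (leftExcursion e₁) climb

    sweeps : ∀ i {s y} → y + i ≡ k → s ≈ ((0 , wrap y) , sweepTable y) →
      run s (i * sweepTime r) ≈ ((0 , 0) , sweepTable k)
    sweeps zero {y = y} y≡k e rewrite +-identityʳ y | y≡k | wrap-k = e
    sweeps (suc i) {y = y} y+i≡k e =
      chain (sweepTime r) (i * sweepTime r) (sweepRow (≈-pos e (cong (0 ,_) (wrap-lt y<k)))) λ e′ →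
      sweeps i (trans (sym (+-suc y i)) y+i≡k) e′
      where
      y<k : y < k
      y<k = subst (y <_) y+i≡k (m<m+n y z<s)

    phase : ∀ {s} → s ≈ ((0 , 0) , exploredTable r) → run s (phaseTime r) ≈ ((0 , 0) , exploredTable (suc r))
    phase e =
      chain k _ (centreLap e) λ e₁ →
      chain 1 _ (leaveCentreEast e₁) λ e₂ →
      chain (r * tourTime) _ (rightTours r z<s refl e₂) λ e₃ →
      chain (suc r + 1) _ (crossToLeft e₃) λ e₄ →
      chain (r * tourTime) _ (leftTours r ≤-refl e₄) λ e₅ →
      chain (suc r + 1) _ (returnToCentre e₅) λ e₆ →
      ≈-table (sweeps (pred k) (suc-pred k {{>-nonZero 0<k}}) e₆) explored
      where
      0<k : 0 < k
      0<k = proj₂ (in-square e)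
      explored : ∀ a b → a < k → b < k → sweepTable k a b ≡ exploredTable (suc r) a b
      explored a b a<k b<k rewrite <ᵇ-true b<k = sym (exploredTable-end a b a<k)

  elapsed : ℕ → ℕ
  elapsed zero = 0
  elapsed (suc r) = elapsed r + phaseTime r

  phaseTime-≥ : ∀ r → k + (r * k + r * k) ≤ phaseTime r
  phaseTime-≥ r = +-monoʳ-≤ k (begin
    r * k + r * k                    ≤⟨ +-mono-≤ rk≤rT rk≤rT ⟩
    r * tourTime + r * tourTime      ≤⟨ +-monoʳ-≤ (r * tourTime) (≤-trans (m≤m+n _ _) (m≤n+m _ (suc r + 1))) ⟩
    r * tourTime + ((suc r + 1) + (r * tourTime + ((suc r + 1) + pred k * sweepTime r)))
                                     ≤⟨ n≤1+n _ ⟩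
    1 + (r * tourTime + ((suc r + 1) + (r * tourTime + ((suc r + 1) + pred k * sweepTime r)))) ∎)
    where
    open ≤-Reasoning
    rk≤rT : r * k ≤ r * tourTime
    rk≤rT = *-monoʳ-≤ r (m≤m+n k (k + 1))

  elapsed-≥ : ∀ r → k * (r * r) ≤ elapsed r
  elapsed-≥ zero = ≤-reflexive (*-zeroʳ k)
  elapsed-≥ (suc r) = begin
    k * (suc r * suc r)                ≡⟨ square-step k r ⟩
    k * (r * r) + (k + (r * k + r * k)) ≤⟨ +-mono-≤ (elapsed-≥ r) (phaseTime-≥ r) ⟩
    elapsed r + phaseTime r            ∎
    where
    open ≤-Reasoning
    square-step : ∀ k r → k * (suc r * suc r) ≡ k * (r * r) + (k + (r * k + r * k))
    square-step = solve 2 (λ k r → k :* ((con 1 :+ r) :* (con 1 :+ r)) := k :* (r :* r) :+ (k :+ (r :* k :+ r :* k))) refl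

  start : Config
  start = (0 , 0) , exploredTable 0

  allPhases : R + R < k → ∀ r → r ≤ R → run start (elapsed r) ≈ ((0 , 0) , exploredTable r)
  allPhases 2R<k zero _ = ≈-refl (0<k , 0<k)
    where
    0<k : 0 < k
    0<k = ≤-<-trans z≤n 2R<k
  allPhases 2R<k (suc r) r<R =
    chain (elapsed r) (phaseTime r) (allPhases 2R<k r (<⇒≤ r<R)) (Phase.phase r lf lf+r+1≡k r<R R<lf)
    where
    lf = k ∸ suc r
    R+r+1<k : suc R + suc r ≤ k
    R+r+1<k = ≤-trans (s≤s (+-monoʳ-≤ R r<R)) 2R<k
    lf+r+1≡k : lf + suc r ≡ k
    lf+r+1≡k = m∸n+n≡m (m+n≤o⇒n≤o (suc R) R+r+1<k)
    R<lf : R < lf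
    R<lf = subst (_≤ lf) (m+n∸n≡m (suc R) (suc r)) (∸-monoˡ-≤ (suc r) R+r+1<k)

  frontier-fresh : suc (suc (R + R)) ≤ k → exploredTable R (suc R) 0 ≡ fresh
  frontier-fresh 2R+2≤k rewrite <ᵇ-false {suc R} {suc R} ≤-refl
                             | <ᵇ-true {suc R} {k ∸ R}
                                 (subst (_≤ k ∸ R) (m+n∸n≡m (suc (suc R)) R) (∸-monoˡ-≤ R 2R+2≤k)) = refl

-- The period-4 rotor pattern q0 q1 q2 q3 q0 …; every rotor sequence of the
-- realisation reads it at its positions.
cycle : ℕ → Rotor
cycle zero = q0
cycle (suc n) = advance (cycle n)

cycle-fresh : ∀ n → cycle n ≢ fresh
cycle-fresh zero ()
cycle-fresh (suc n) = advance-fresh (cycle n)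
  where
  advance-fresh : ∀ x → advance x ≢ fresh
  advance-fresh fresh ()
  advance-fresh q0 ()
  advance-fresh q1 ()
  advance-fresh q2 ()
  advance-fresh q3 ()

cycle-4 : ∀ a → cycle (4 + a) ≡ cycle a
cycle-4 zero = refl
cycle-4 (suc a) = advance⁴ (cycle a)
  where
  advance⁴ : ∀ x → advance (advance (advance (advance (advance x)))) ≡ advance x
  advance⁴ fresh = refl
  advance⁴ q0 = refl
  advance⁴ q1 = refl
  advance⁴ q2 = refl
  advance⁴ q3 = refl

cycle-periodic : ∀ j a → cycle (j * 4 + a) ≡ cycle a
cycle-periodic zero a = refl
cycle-periodic (suc j) a rewrite +-assoc 4 (j * 4) a = trans (cycle-4 (j * 4 + a)) (cycle-periodic j a)

cycle-mod : ∀ n L → cycle (n % (4 * suc L)) ≡ cycle n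
cycle-mod n L = begin
  cycle (n % N)                               ≡⟨ sym (cycle-periodic (n / N * suc L) (n % N)) ⟩
  cycle (n / N * suc L * 4 + n % N)           ≡⟨ cong (λ z → cycle (z + n % N)) multiple ⟩
  cycle (n / N * N + n % N)                   ≡⟨ cong cycle (+-comm (n / N * N) (n % N)) ⟩
  cycle (n % N + n / N * N)                   ≡⟨ cong cycle (sym (m≡m%n+[m/n]*n n N)) ⟩
  cycle n                                     ∎
  where
  open ≡-Reasoning
  N = 4 * suc L
  multiple : n / N * suc L * 4 ≡ n / N * N
  multiple = trans (*-assoc (n / N) (suc L) 4) (cong (n / N *_) (*-comm (suc L) 4))

countTrue : (ℕ → Bool) → ℕ → ℕ
countTrue g zero = 0
countTrue g (suc n) = (if g 0 then 1 else 0) + countTrue (g ∘ suc) n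

countTrue-cong : ∀ n {g h} → (∀ j → g j ≡ h j) → countTrue g n ≡ countTrue h n
countTrue-cong zero _ = refl
countTrue-cong (suc n) g≗h = cong₂ _+_ (cong (λ b → if b then 1 else 0) (g≗h 0)) (countTrue-cong n (g≗h ∘ suc))

countTrue-+ : ∀ m n g → countTrue g (m + n) ≡ countTrue g m + countTrue (λ j → g (m + j)) n
countTrue-+ zero n g = refl
countTrue-+ (suc m) n g = trans (cong ((if g 0 then 1 else 0) +_) (countTrue-+ m n (g ∘ suc)))
                                (sym (+-assoc (if g 0 then 1 else 0) _ _))

countTrue-periodic : ∀ g → (∀ j → g (4 + j) ≡ g j) → countTrue g 4 ≡ 1 → ∀ M → countTrue g (M * 4) ≡ M
countTrue-periodic g period once zero = refl
countTrue-periodic g period once (suc M) =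
  trans (countTrue-+ 4 (M * 4) g)
        (cong₂ _+_ once (trans (countTrue-cong (M * 4) period) (countTrue-periodic g period once M)))

length-filter-tabulate : ∀ {n} {X : Set} (h : Fin n → X) {P : Pred X 0ℓ} (P? : Decidable P) (g : ℕ → Bool) →
  (∀ i → does (P? (h i)) ≡ g (toℕ i)) → length (filter P? (tabulate h)) ≡ countTrue g n
length-filter-tabulate {zero} h P? g agree = refl
length-filter-tabulate {suc n} h P? g agree with does (P? (h fz)) | agree fz
... | true | e rewrite sym e = cong suc (length-filter-tabulate (h ∘ fs) P? (g ∘ suc) (agree ∘ fs))
... | false | e rewrite sym e = length-filter-tabulate (h ∘ fs) P? (g ∘ suc) (agree ∘ fs)

module Neighbours (K : ℕ) where

  k : ℕ
  k = 3 + K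

  open Torus k

  eastF westF : Fin k → Fin k
  eastF x = fromℕ< (east-lt (toℕ<n x))
  westF x = fromℕ< (west-lt (toℕ<n x))

  toℕ-eastF : ∀ x → toℕ (eastF x) ≡ east (toℕ x)
  toℕ-eastF x = toℕ-fromℕ< (east-lt (toℕ<n x))

  toℕ-westF : ∀ x → toℕ (westF x) ≡ west (toℕ x)
  toℕ-westF x = toℕ-fromℕ< (west-lt (toℕ<n x))

  neighbour : V k → Dir → V k
  neighbour (x , y) dE = eastF x , y
  neighbour (x , y) dW = westF x , y
  neighbour (x , y) dN = x , eastF y
  neighbour (x , y) dS = x , westF y

  toPos : V k → ℕ × ℕ
  toPos (x , y) = toℕ x , toℕ y

  toPos-neighbour : ∀ u d → toPos (neighbour u d) ≡ move d (toPos u)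
  toPos-neighbour (x , y) dE = cong (_, toℕ y) (toℕ-eastF x)
  toPos-neighbour (x , y) dW = cong (_, toℕ y) (toℕ-westF x)
  toPos-neighbour (x , y) dN = cong (toℕ x ,_) (toℕ-eastF y)
  toPos-neighbour (x , y) dS = cong (toℕ x ,_) (toℕ-westF y)

  cycAdj-east : ∀ i → CycAdj i (eastF i)
  cycAdj-east i with suc (toℕ i) ≡ᵇ k | ≡ᵇ-reflects-≡ (suc (toℕ i)) k | toℕ-eastF i
  ... | true | ofʸ i+1≡k | e = inj₂ (inj₂ (inj₂ (e , i+1≡k)))
  ... | false | ofⁿ _ | e = inj₁ (sym e)

  cycAdj-west : ∀ i → CycAdj i (westF i)
  cycAdj-west i = by-cases (toℕ i) refl (toℕ-westF i)
    where
    by-cases : ∀ a → toℕ i ≡ a → toℕ (westF i) ≡ west a → CycAdj i (westF i)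
    by-cases zero i≡0 e = inj₂ (inj₂ (inj₁ (i≡0 , cong suc e)))
    by-cases (suc a) i≡a+1 e = inj₂ (inj₁ (trans (cong suc e) (sym i≡a+1)))

  cycAdj-inv : ∀ {i j} → CycAdj i j → (j ≡ eastF i) ⊎ (j ≡ westF i)
  cycAdj-inv {i} {j} (inj₁ i+1≡j) =
    inj₁ (toℕ-injective (sym (trans (toℕ-eastF i) (trans (wrap-lt (subst (_< k) (sym i+1≡j) (toℕ<n j))) i+1≡j))))
  cycAdj-inv {i} {j} (inj₂ (inj₁ j+1≡i)) =
    inj₂ (toℕ-injective (sym (trans (toℕ-westF i) (cong west (sym j+1≡i)))))
  cycAdj-inv {i} {j} (inj₂ (inj₂ (inj₁ (i≡0 , j+1≡k)))) =
    inj₂ (toℕ-injective (sym (trans (toℕ-westF i) (trans (cong west i≡0) (cong pred (sym j+1≡k))))))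
  cycAdj-inv {i} {j} (inj₂ (inj₂ (inj₂ (j≡0 , i+1≡k)))) =
    inj₁ (toℕ-injective (sym (trans (toℕ-eastF i) (trans (cong wrap i+1≡k) (trans wrap-k (sym j≡0))))))

  neighbour-adj : ∀ u d → Adj u (neighbour u d)
  neighbour-adj (x , y) dE = inj₂ (refl , cycAdj-east x)
  neighbour-adj (x , y) dW = inj₂ (refl , cycAdj-west x)
  neighbour-adj (x , y) dN = inj₁ (refl , cycAdj-east y)
  neighbour-adj (x , y) dS = inj₁ (refl , cycAdj-west y)

  adj-neighbour : ∀ {u w} → Adj u w → Σ Dir (λ d → w ≡ neighbour u d)
  adj-neighbour {x , y} (inj₁ (refl , c)) with cycAdj-inv c
  ... | inj₁ e = dN , cong (x ,_) e
  ... | inj₂ e = dS , cong (x ,_) e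
  adj-neighbour {x , y} (inj₂ (refl , c)) with cycAdj-inv c
  ... | inj₁ e = dE , cong (_, y) e
  ... | inj₂ e = dW , cong (_, y) e

  east≢id : ∀ a → east a ≢ a
  east≢id a with suc a ≡ᵇ k | ≡ᵇ-reflects-≡ (suc a) k
  ... | true | ofʸ a+1≡k = λ 0≡a → 0≢1+n (suc-injective (trans (cong suc 0≡a) a+1≡k))
  ... | false | ofⁿ _ = λ a+1≡a → <-irrefl (sym a+1≡a) ≤-refl

  west≢id : ∀ a → west a ≢ a
  west≢id zero ()
  west≢id (suc a) a≡a+1 = <-irrefl a≡a+1 ≤-refl

  east≢west : ∀ a → east a ≢ west a
  east≢west zero ()
  east≢west (suc a) with suc (suc a) ≡ᵇ k | ≡ᵇ-reflects-≡ (suc (suc a)) k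
  ... | true | ofʸ a+2≡k = λ 0≡a → 0≢1+n (suc-injective (suc-injective (trans (cong (2 +_) 0≡a) a+2≡k)))
  ... | false | ofⁿ _ = λ a+2≡a → <-irrefl (sym a+2≡a) (<-trans (n<1+n a) (n<1+n (suc a)))

  eastF≢id : ∀ x → eastF x ≢ x
  eastF≢id x e = east≢id (toℕ x) (trans (sym (toℕ-eastF x)) (cong toℕ e))

  westF≢id : ∀ x → westF x ≢ x
  westF≢id x e = west≢id (toℕ x) (trans (sym (toℕ-westF x)) (cong toℕ e))

  eastF≢westF : ∀ x → eastF x ≢ westF x
  eastF≢westF x e = east≢west (toℕ x) (trans (sym (toℕ-eastF x)) (trans (cong toℕ e) (toℕ-westF x)))

  neighbour-injective : ∀ u d d′ → neighbour u d ≡ neighbour u d′ → d ≡ d′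
  neighbour-injective u dE dE e = refl
  neighbour-injective u dW dW e = refl
  neighbour-injective u dN dN e = refl
  neighbour-injective u dS dS e = refl
  neighbour-injective (x , y) dE dW e = ⊥-elim (eastF≢westF x (cong proj₁ e))
  neighbour-injective (x , y) dE dN e = ⊥-elim (eastF≢id x (cong proj₁ e))
  neighbour-injective (x , y) dE dS e = ⊥-elim (eastF≢id x (cong proj₁ e))
  neighbour-injective (x , y) dW dE e = ⊥-elim (eastF≢westF x (sym (cong proj₁ e)))
  neighbour-injective (x , y) dW dN e = ⊥-elim (westF≢id x (cong proj₁ e))
  neighbour-injective (x , y) dW dS e = ⊥-elim (westF≢id x (cong proj₁ e))
  neighbour-injective (x , y) dN dE e = ⊥-elim (eastF≢id x (sym (cong proj₁ e)))
  neighbour-injective (x , y) dN dW e = ⊥-elim (westF≢id x (sym (cong proj₁ e)))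
  neighbour-injective (x , y) dN dS e = ⊥-elim (eastF≢westF y (cong proj₂ e))
  neighbour-injective (x , y) dS dE e = ⊥-elim (eastF≢id x (sym (cong proj₁ e)))
  neighbour-injective (x , y) dS dW e = ⊥-elim (westF≢id x (sym (cong proj₁ e)))
  neighbour-injective (x , y) dS dN e = ⊥-elim (eastF≢westF y (sym (cong proj₂ e)))

  ≟V-by-coordinates : ∀ (v p : V k) →
    does (v ≟V p) ≡ (toℕ (proj₁ v) ≡ᵇ toℕ (proj₁ p)) ∧ (toℕ (proj₂ v) ≡ᵇ toℕ (proj₂ p))
  ≟V-by-coordinates (vx , vy) (px , py) = det (proof ((vx , vy) ≟V (px , py)))
    (reflects-⇔ (λ (ex , ey) → cong₂ _,_ (toℕ-injective ex) (toℕ-injective ey))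
                (λ e → cong (toℕ ∘ proj₁) e , cong (toℕ ∘ proj₂) e)
                (≡ᵇ-reflects-≡ (toℕ vx) (toℕ px) ×-reflects ≡ᵇ-reflects-≡ (toℕ vy) (toℕ py)))

  neighbour-test : ∀ u d d′ → does (neighbour u d′ ≟V neighbour u d) ≡ does (d′ ≟D d)
  neighbour-test u d d′ = det (proof (neighbour u d′ ≟V neighbour u d))
                              (reflects-⇔ (cong (neighbour u)) (neighbour-injective u d′ d) (proof (d′ ≟D d)))

module Counters {k : ℕ} {m : V k → ℕ} (Rs : RotorSystem k m) (s : V k) where

  counter : ℕ → V k → ℕ
  counter t = proj₂ (walkState Rs s t)

  counter-step : ∀ t v → counter t v ≤ counter (suc t) v
  counter-step t v with v ≟V walk Rs s t
  ... | yes _ = n≤1+n _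
  ... | no _ = ≤-refl

  counter-mono : ∀ {i j} v → i ≤ j → counter i v ≤ counter j v
  counter-mono {i} {j} v i≤j with m≤n⇒m<n∨m≡n i≤j
  ... | inj₂ refl = ≤-refl
  counter-mono {i} {suc j} v _ | inj₁ (s≤s i≤j) = ≤-trans (counter-mono v i≤j) (counter-step j v)

  counter-visit : ∀ i v → walk Rs s i ≡ v → counter (suc i) v ≡ suc (counter i v)
  counter-visit i v here with v ≟V walk Rs s i
  ... | yes _ = refl
  ... | no v≢here = ⊥-elim (v≢here (sym here))

  cover-after : ∀ T v → counter T v ≡ counter 0 v → walk Rs s T ≢ v → ∀ t → CoveredBy Rs s t → T < t
  cover-after T v unchanged absent t covered with covered v
  ... | i , i≤t , visit with <-cmp i T
  ... | tri< i<T _ _ = ⊥-elim (<-irrefl refl (begin-strict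
        counter 0 v          ≤⟨ counter-mono {0} {i} v z≤n ⟩
        counter i v          <⟨ ≤-reflexive (sym (counter-visit i v visit)) ⟩
        counter (suc i) v    ≤⟨ counter-mono v i<T ⟩
        counter T v          ≡⟨ unchanged ⟩
        counter 0 v          ∎))
    where open ≤-Reasoning
  ... | tri≈ _ refl _ = ⊥-elim (absent visit)
  ... | tri> _ _ T<i = <-≤-trans T<i i≤t

-- `Tracks n x`: a counter n is represented by the model rotor x (fresh iff n = 0).
data Tracks : ℕ → Rotor → Set where
  tracks-fresh : Tracks 0 fresh
  tracks-cycle : ∀ n → Tracks n (cycle n)

tracks-advance : ∀ {n x} → Tracks n x → Tracks (suc n) (advance x)
tracks-advance tracks-fresh = tracks-cycle 1
tracks-advance (tracks-cycle n) = tracks-cycle (suc n)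

tracks-unused : ∀ {n x} → Tracks n x → x ≡ fresh → n ≡ 0
tracks-unused tracks-fresh _ = refl
tracks-unused (tracks-cycle n) is-fresh = ⊥-elim (cycle-fresh n is-fresh)

module Realisation (K R : ℕ) where

  open Neighbours K public
  open Walk k R public

  -- A fresh rotor points where a q0 rotor does, so tracking rotors point like their counters.
  dir-fresh : ∀ a → dir a fresh ≡ dir a q0
  dir-fresh zero = refl
  dir-fresh (suc a) with a <ᵇ R
  ... | true = refl
  ... | false = refl

  tracks-dir : ∀ a {n x} → Tracks n x → dir a x ≡ dir a (cycle n)
  tracks-dir a tracks-fresh = dir-fresh a
  tracks-dir a (tracks-cycle n) = refl

  -- Each table `dir a` is a bijection from q0..q3 to the four directions.
  dir-once : ∀ a d → countTrue (λ j → does (dir a (cycle j) ≟D d)) 4 ≡ 1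
  dir-once zero d = centre-once d
    where
    centre-once : ∀ d → countTrue (λ j → does (centreDir (cycle j) ≟D d)) 4 ≡ 1
    centre-once dE = refl
    centre-once dW = refl
    centre-once dN = refl
    centre-once dS = refl
  dir-once (suc a) d with a <ᵇ R
  ... | true = right-once d
    where
    right-once : ∀ d → countTrue (λ j → does (rightDir (cycle j) ≟D d)) 4 ≡ 1
    right-once dE = refl
    right-once dW = refl
    right-once dN = refl
    right-once dS = refl
  ... | false = left-once d
    where
    left-once : ∀ d → countTrue (λ j → does (leftDir (cycle j) ≟D d)) 4 ≡ 1
    left-once dE = refl
    left-once dW = refl
    left-once dN = refl
    left-once dS = refl

  column : V k → ℕ
  column u = toℕ (proj₁ u)

  -- For the rotor lengths 4(m u + 1): the rotor sequence of u reads the pattern `cycle`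
  -- through the table of its column.  Column 0 starts at position 1 (q1), the others at 0.
  module System (m : V k → ℕ) where

    sequence : (u : V k) → Fin (Len m u) → V k
    sequence u i = neighbour u (dir (column u) (cycle (toℕ i)))

    sequence-count : ∀ u w → Adj u w → count (sequence u) w ≡ suc (m u)
    sequence-count u w adj with adj-neighbour adj
    ... | d , refl = begin
      count (sequence u) (neighbour u d)  ≡⟨ length-filter-tabulate id (λ i → sequence u i ≟V neighbour u d) hits
                                                (λ i → neighbour-test u d (dir (column u) (cycle (toℕ i)))) ⟩
      countTrue hits (4 * suc (m u))      ≡⟨ cong (countTrue hits) (*-comm 4 (suc (m u))) ⟩
      countTrue hits (suc (m u) * 4)      ≡⟨ countTrue-periodic hits periodic (dir-once (column u) d) (suc (m u)) ⟩
      suc (m u)                           ∎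
      where
      open ≡-Reasoning
      hits : ℕ → Bool
      hits j = does (dir (column u) (cycle j) ≟D d)
      periodic : ∀ j → hits (4 + j) ≡ hits j
      periodic j = cong (λ x → does (dir (column u) x ≟D d)) (cycle-4 j)

    1<Len : ∀ u → 1 < Len m u
    1<Len u = ≤-trans (s≤s (s≤s z≤n)) (*-monoʳ-≤ 4 (s≤s (z≤n {m u})))

    initial : (u : V k) → Fin (Len m u)
    initial (fz , y) = fromℕ< (1<Len (fz , y))
    initial (fs x , y) = fromℕ< {0} (s≤s z≤n)

    system : RotorSystem k m
    system = record
      { seq = sequence
      ; seq-adj = λ u i → neighbour-adj u (dir (column u) (cycle (toℕ i)))
      ; seq-cnt = sequence-count
      ; init = initial
      }

    origin : V k
    origin = fz , fz

    Simulates : State k → Config → Set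
    Simulates (p , c) (q , f) = (toPos p ≡ q) × (∀ v → Tracks (c v) (f (toℕ (proj₁ v)) (toℕ (proj₂ v))))

    simulate-step : ∀ p c f → Simulates (p , c) (toPos p , f) → Simulates (Defs.step system (p , c)) (mstep (toPos p , f))
    simulate-step (px , py) c f (_ , tracks) = same-move , advanced
      where
      p = (px , py)
      a = toℕ px
      b = toℕ py
      rotor-dir : dir a (cycle (toℕ (rotorIndex m p (c p)))) ≡ dir a (f a b)
      rotor-dir = begin
        dir a (cycle (toℕ (rotorIndex m p (c p))))  ≡⟨ cong (dir a ∘ cycle) (toℕ-fromℕ< (m%n<n (c p) (Len m p))) ⟩
        dir a (cycle (c p % Len m p))               ≡⟨ cong (dir a) (cycle-mod (c p) (m p)) ⟩
        dir a (cycle (c p))                         ≡⟨ sym (tracks-dir a (tracks p)) ⟩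
        dir a (f a b)                               ∎
        where open ≡-Reasoning
      same-move : toPos (sequence p (rotorIndex m p (c p))) ≡ move (dir a (f a b)) (a , b)
      same-move = trans (toPos-neighbour p _) (cong (λ d → move d (a , b)) rotor-dir)
      advanced : ∀ v → Tracks (if does (v ≟V p) then suc (c v) else c v)
                              (bump f (a , b) (toℕ (proj₁ v)) (toℕ (proj₂ v)))
      advanced v rewrite ≟V-by-coordinates v p with (toℕ (proj₁ v) ≡ᵇ a) ∧ (toℕ (proj₂ v) ≡ᵇ b)
      ... | true = tracks-advance (tracks v)
      ... | false = tracks v

    simulation : ∀ t → Simulates (walkState system origin t) (run start t)
    simulation zero = refl , initially
      where
      initially : ∀ v → Tracks (toℕ (initial v)) (exploredTable 0 (toℕ (proj₁ v)) (toℕ (proj₂ v)))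
      initially (fz , y) rewrite toℕ-fromℕ< (1<Len (fz , y)) = tracks-cycle 1
      initially (fs x , y) rewrite toℕ-fromℕ< {0} {Len m (fs x , y)} (s≤s z≤n)
                                 | <ᵇ-true {toℕ x} {2 + K} (≤-pred (toℕ<n (fs x))) = tracks-fresh
    simulation (suc t) with walkState system origin t | run start t | simulation t
    ... | p , c | q , f | refl , tracks = simulate-step p c f (refl , tracks)

    open Counters system origin

    late-cover : suc (suc (R + R)) ≤ k → ∀ t → CoveredBy system origin t → elapsed R < t
    late-cover 2R+2≤k = cover-after (elapsed R) target unused absent
      where
      R+1<k : suc R < k
      R+1<k = ≤-trans (s≤s (s≤s (m≤m+n R R))) 2R+2≤k
      target : V k
      target = fromℕ< R+1<k , fz
      phases : run start (elapsed R) ≈ ((0 , 0) , exploredTable R)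
      phases = allPhases (≤-trans (n≤1+n _) 2R+2≤k) R ≤-refl
      target-fresh : proj₂ (run start (elapsed R)) (toℕ (proj₁ target)) 0 ≡ fresh
      target-fresh = begin
        proj₂ (run start (elapsed R)) (toℕ (fromℕ< R+1<k)) 0  ≡⟨ cong (λ a → proj₂ (run start (elapsed R)) a 0)
                                                                      (toℕ-fromℕ< R+1<k) ⟩
        proj₂ (run start (elapsed R)) (suc R) 0               ≡⟨ same-table phases (suc R) 0 R+1<k z<s ⟩
        exploredTable R (suc R) 0                             ≡⟨ frontier-fresh 2R+2≤k ⟩
        fresh                                                 ∎
        where open ≡-Reasoning
      unused : counter (elapsed R) target ≡ counter 0 target
      unused = tracks-unused (proj₂ (simulation (elapsed R)) target) target-fresh
      absent : walk system origin (elapsed R) ≢ target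
      absent here = 0≢1+n (cong proj₁ (begin
        (0 , 0)                                      ≡⟨ sym (same-pos phases) ⟩
        proj₁ (run start (elapsed R))                ≡⟨ sym (proj₁ (simulation (elapsed R))) ⟩
        toPos (walk system origin (elapsed R))       ≡⟨ cong toPos here ⟩
        toPos target                                 ≡⟨ cong (_, 0) (toℕ-fromℕ< R+1<k) ⟩
        (suc R , 0)                                  ∎))
        where open ≡-Reasoning

⌈n/2⌉≤1+⌊n/2⌋ : ∀ n → ⌈ n /2⌉ ≤ suc ⌊ n /2⌋
⌈n/2⌉≤1+⌊n/2⌋ zero = z≤n
⌈n/2⌉≤1+⌊n/2⌋ (suc zero) = ≤-refl
⌈n/2⌉≤1+⌊n/2⌋ (suc (suc n)) = s≤s (⌈n/2⌉≤1+⌊n/2⌋ n)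

half-below : ∀ n → ⌊ n /2⌋ + ⌊ n /2⌋ ≤ n
half-below n = subst (⌊ n /2⌋ + ⌊ n /2⌋ ≤_) (⌊n/2⌋+⌈n/2⌉≡n n) (+-monoʳ-≤ ⌊ n /2⌋ (⌊n/2⌋≤⌈n/2⌉ n))

half-above : ∀ n → n ≤ suc (⌊ n /2⌋ + ⌊ n /2⌋)
half-above n = begin
  n                               ≡⟨ sym (⌊n/2⌋+⌈n/2⌉≡n n) ⟩
  ⌊ n /2⌋ + ⌈ n /2⌉               ≤⟨ +-monoʳ-≤ ⌊ n /2⌋ (⌈n/2⌉≤1+⌊n/2⌋ n) ⟩
  ⌊ n /2⌋ + suc ⌊ n /2⌋           ≡⟨ +-suc ⌊ n /2⌋ ⌊ n /2⌋ ⟩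
  suc (⌊ n /2⌋ + ⌊ n /2⌋)         ∎
  where open ≤-Reasoning

cube-bound : ∀ K R → K ≤ R + R → (3 + K) ^ 3 ≤ 27 * suc ((3 + K) * (R * R))
cube-bound zero zero _ = ≤-refl
cube-bound K (suc R′) K≤2R = begin
  k ^ 3                  ≡⟨ cong (λ z → k * (k * z)) (*-identityʳ k) ⟩
  k * (k * k)            ≤⟨ *-monoʳ-≤ k (*-mono-≤ k≤5R k≤5R) ⟩
  k * (5 * R * (5 * R))  ≡⟨ regroup k R ⟩
  25 * (k * (R * R))     ≤⟨ *-monoˡ-≤ (k * (R * R)) (m≤m+n 25 2) ⟩
  27 * (k * (R * R))     ≤⟨ *-monoʳ-≤ 27 (n≤1+n (k * (R * R))) ⟩
  27 * suc (k * (R * R)) ∎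
  where
  open ≤-Reasoning
  k = 3 + K
  R = suc R′
  k≤5R : k ≤ 5 * R
  k≤5R = begin
    3 + K            ≤⟨ +-monoʳ-≤ 3 K≤2R ⟩
    3 + (R + R)      ≤⟨ +-monoˡ-≤ (R + R) (*-monoʳ-≤ 3 (s≤s (z≤n {R′}))) ⟩
    3 * R + (R + R)  ≡⟨ solve 1 (λ r → con 3 :* r :+ (r :+ r) := con 5 :* r) refl R ⟩
    5 * R            ∎
  regroup : ∀ k r → k * (5 * r * (5 * r)) ≡ 25 * (k * (r * r))
  regroup = solve 2 (λ k r → k :* ((con 5 :* r) :* (con 5 :* r)) := con 25 :* (k :* (r :* r))) refl

-- Theorem 4.7: with R = ⌊(k - 2)/2⌋, covering takes more than the ≥ k R² steps of the
-- first R phases, and k³ ≤ 27 (1 + k R²).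
theorem4p7 : ∃ λ (p : ℕ) → ∃ λ (q : ℕ) → 0 < p × 0 < q ×
    (∀ (k : ℕ) → 3 ≤ k → ∀ (m : V k → ℕ) →
      Σ (V k) λ s → Σ (RotorSystem k m) λ R →
        ∀ (t : ℕ) → CoveredBy R s t → p * k ^ 3 ≤ q * t)
theorem4p7 = 1 , 27 , z<s , z<s , bound
  where
  bound : ∀ (k : ℕ) → 3 ≤ k → ∀ (m : V k → ℕ) →
    Σ (V k) λ s → Σ (RotorSystem k m) λ Rs → ∀ (t : ℕ) → CoveredBy Rs s t → 1 * k ^ 3 ≤ 27 * t
  bound (suc (suc (suc K))) (s≤s (s≤s (s≤s z≤n))) m = origin , system , λ t covered → begin
    1 * (3 + K) ^ 3                  ≡⟨ *-identityˡ _ ⟩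
    (3 + K) ^ 3                      ≤⟨ cube-bound K R (≤-pred (half-above (suc K))) ⟩
    27 * suc ((3 + K) * (R * R))     ≤⟨ *-monoʳ-≤ 27 (s≤s (elapsed-≥ R)) ⟩
    27 * suc (elapsed R)             ≤⟨ *-monoʳ-≤ 27 (late-cover (s≤s (s≤s (half-below (suc K)))) t covered) ⟩
    27 * t                           ∎
    where
    R = ⌊ suc K /2⌋
    open Realisation K R
    open System m
    open ≤-Reasoning
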